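{- Let $\Gamma$ be a finite bipartite graph with $|V(\Gamma)|\geq 4$. Then the following assertions are equivalent: (1) $\Gamma$ has no induced subgraph isomorphic to the path $P_5$ on $5$ vertices, and $\Gamma$ is prime; (2) $\Gamma$ is critical; (3) $\Gamma$ is a half graph.
   Context: A module of a graph $\Gamma$ is a set $M\subseteq V(\Gamma)$ such that each vertex outside $M$ is adjacent to all or to none of the vertices of $M$; $\emptyset$, $V(\Gamma)$ and singletons are trivial modules. $\Gamma$ is prime if $|V(\Gamma)|\geq 3$ and all its modules are trivial. A prime graph $\Gamma$ is critical if $\Gamma-v$ is not prime for every $v\in V(\Gamma)$. A bipartite graph $\Gamma$ with bipartition $\{X,Y\}$ is a half graph if there exist a linear order $L$ on $X$ and a bijection $\varphi:X\to Y$ such that $E(\Gamma)=\{\{x,\varphi(x')\}: x\leq x' \bmod L\}$. -}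

module Defs where

open import Data.Nat using (ℕ; zero; suc; _≤_)
open import Data.Fin using (Fin; punchIn; toℕ)
open import Data.Bool using (Bool; true; false)
open import Data.Product using (Σ; ∃; ∃-syntax; _×_; _,_)
open import Data.Sum using (_⊎_)
open import Data.Empty using (⊥)
open import Relation.Nullary using (¬_)
open import Relation.Binary.PropositionalEquality using (_≡_; refl)
open import Relation.Binary using (Rel; IsTotalOrder)
open import Level using (0ℓ)
open import Function.Definitions using (Injective; Bijective)

record Graph (n : ℕ) : Set where
  field
    adj    : Fin n → Fin n → Bool
    sym    : ∀ u v → adj u v ≡ adj v u
    irrefl : ∀ v → adj v v ≡ false
open Graph public

Adj : ∀ {n} → Graph n → Fin n → Fin n → Set
Adj G u v = adj G u v ≡ true

HasInducedCopy : ∀ {k n} → Graph k → Graph n → Set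
HasInducedCopy {k} {n} H G =
  Σ (Fin k → Fin n) λ f → Injective _≡_ _≡_ f × (∀ i j → adj G (f i) (f j) ≡ adj H i j)

step : ℕ → ℕ → Bool
step (suc a) (suc b)    = step a b
step zero    (suc zero) = true
step (suc zero) zero    = true
step _ _                = false

step-sym : ∀ a b → step a b ≡ step b a
step-sym (suc a) (suc b) = step-sym a b
step-sym zero zero = refl
step-sym zero (suc zero) = refl
step-sym zero (suc (suc b)) = refl
step-sym (suc zero) zero = refl
step-sym (suc (suc a)) zero = refl

step-irr : ∀ a → step a a ≡ false
step-irr zero = refl
step-irr (suc a) = step-irr a

Path : (k : ℕ) → Graph k
Path k = record
  { adj    = λ i j → step (toℕ i) (toℕ j)
  ; sym    = λ i j → step-sym (toℕ i) (toℕ j)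
  ; irrefl = λ i → step-irr (toℕ i)
  }

P5 : Graph 5
P5 = Path 5

Subset : ℕ → Set
Subset n = Fin n → Bool

IsModule : ∀ {n} → Graph n → Subset n → Set
IsModule G M = ∀ v → M v ≡ false →
  ∀ a b → M a ≡ true → M b ≡ true → adj G v a ≡ adj G v b

IsTrivialModule : ∀ {n} → Subset n → Set
IsTrivialModule M =
    (∀ v → M v ≡ false)
  ⊎ (∀ v → M v ≡ true)
  ⊎ (Σ _ λ a → ∀ v → (M v ≡ true → v ≡ a) × (v ≡ a → M v ≡ true))

Prime : ∀ {n} → Graph n → Set
Prime {n} G = 3 ≤ n × (∀ M → IsModule G M → IsTrivialModule M)

_─_ : ∀ {m} → Graph (suc m) → Fin (suc m) → Graph m
G ─ v = record
  { adj    = λ i j → adj G (punchIn v i) (punchIn v j)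
  ; sym    = λ i j → sym G (punchIn v i) (punchIn v j)
  ; irrefl = λ i → irrefl G (punchIn v i)
  }

Critical : ∀ {n} → Graph n → Set
Critical {zero}  G = Prime G
Critical {suc m} G = Prime G × (∀ v → ¬ Prime (G ─ v))

-- Bipartite graphs with a given bipartition {X, Y}:
-- side v ≡ false means v ∈ X, side v ≡ true means v ∈ Y.

IsBipartition : ∀ {n} → Graph n → (Fin n → Bool) → Set
IsBipartition G side = ∀ u v → Adj G u v → side u ≡ side v → ⊥

Part : ∀ {n} → (Fin n → Bool) → Bool → Set
Part side b = Σ _ λ v → side v ≡ b

-- Half graph w.r.t. the bipartition side: a linear order L on X and a
-- bijection φ : X → Y with E(Γ) = {{x, φ(x')} : x ≤_L x'}.
IsHalfGraph : ∀ {n} → Graph n → (Fin n → Bool) → Set₁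
IsHalfGraph G side =
  let X = Part side false ; Y = Part side true in
  Σ (Rel X 0ℓ) λ _≤L_ → IsTotalOrder _≡_ _≤L_ ×
  Σ (X → Y) λ φ → Bijective _≡_ _≡_ φ ×
  (∀ u v → (Adj G u v →
              Σ X λ x → Σ X λ x' → x ≤L x' ×
                (  (u ≡ Σ.proj₁ x × v ≡ Σ.proj₁ (φ x'))
                 ⊎ (v ≡ Σ.proj₁ x × u ≡ Σ.proj₁ (φ x'))))
         × ((Σ X λ x → Σ X λ x' → x ≤L x' ×
                (  (u ≡ Σ.proj₁ x × v ≡ Σ.proj₁ (φ x'))
                 ⊎ (v ≡ Σ.proj₁ x × u ≡ Σ.proj₁ (φ x')))) → Adj G u v))

-- In a prime bipartite graph, having no induced 2K₂ means that the neighbourhoods on each side form a chain;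
-- ordering X by reverse inclusion of neighbourhoods and sending x to its neighbour of least degree then
-- exhibits a half graph, and half graphs are prime and 2K₂-free. An induced 2K₂ in a prime bipartite graph
-- forces an induced P₅, since the vertices far from one of its edges would otherwise split off.
--
-- Call a vertex a (or a pair a, b) a witness of v if N(a) is {v} (or N(a), N(b) differ exactly at v): it makes
-- G - v non-prime, and when G - v is non-prime without one, v is a cut vertex. With nested neighbourhoods every
-- vertex has a witness, so half graphs are critical. Conversely, clearing coordinate v of the adjacency rows
-- merges the two rows of a witness of v; so if the vertices of a set L are witnessed by vertices of a set Q,
-- then |L| plus the number of rows of Q ∪ {∅} still distinct off L is at most 1 + |Q|. In a critical graph this
-- count rules out a least cut side at a vertex without witness (its own vertices are witnessed, as otherwise a
-- smaller cut side appears), so every vertex is witnessed; counting once more, an induced 2K₂ would leave one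
-- side with too many vertices.

module Submission where

open import Defs renaming (sym to adj-sym)
open import Data.Bool using (Bool; true; false; not)
open import Data.Bool.Properties using (¬-not)
import Data.Bool.Properties as Bool
open import Data.Empty using (⊥; ⊥-elim)
open import Data.Fin using (Fin; zero; suc; punchIn; punchOut; _≟_; #_)
import Data.Fin as Fin
open import Data.Fin.Properties
  using (any?; all?; suc-injective; ¬∀⟶∃¬; <-cmp; punchInᵢ≢i; punchIn-injective; punchIn-punchOut;
         punchOut-punchIn; punchOut-cong)
open import Data.List using (List; []; _∷_; map; length)
open import Data.List.Properties using (length-map; map-∘; map-id)
open import Data.List.Membership.Propositional using (_∈_)
open import Data.List.Membership.Propositional.Properties using (∈-map⁺; ∈-map⁻)
import Data.List.Membership.DecPropositional as DecMembership
open import Data.List.Relation.Unary.All using (All; []; _∷_)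
import Data.List.Relation.Unary.All as All
import Data.List.Relation.Unary.All.Properties as AllP
open import Data.List.Relation.Unary.AllPairs using (AllPairs; []; _∷_)
open import Data.List.Relation.Unary.Any using (here; there)
open import Data.List.Relation.Unary.Unique.Propositional using (Unique)
import Data.List.Relation.Unary.Unique.Propositional.Properties as Unique
open import Data.Maybe using (Maybe; just; nothing)
open import Data.Nat using (ℕ; zero; suc; _≤_; _<_; _+_; z≤n; s≤s)
import Data.Nat.Properties as ℕ
open import Data.Product using (Σ; ∃; _×_; _,_; proj₁; proj₂)
open import Data.Sum using (_⊎_; inj₁; inj₂; [_,_])
open import Data.Unit using (⊤; tt)
open import Data.Vec using (Vec; lookup; tabulate; _[_]≔_)
import Data.Vec as Vec
open import Data.Vec.Properties
  using (lookup∘tabulate; tabulate∘lookup; tabulate-cong; lookup∘update; lookup∘update′; ≡-dec)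
open import Function using (_∘_; flip)
open import Function.Bundles using (_⇔_; mk⇔)
open import Function.Definitions using (Injective; Surjective)
open import Level using (0ℓ)
open import Relation.Binary.Bundles using (TotalPreorder)
import Relation.Binary.Construct.Flip.EqAndOrd as Flip
open import Relation.Binary.Core using (Rel)
open import Relation.Binary.Definitions using (DecidableEquality; tri<; tri≈; tri>)
open import Relation.Binary.PropositionalEquality using (_≡_; _≢_; refl; sym; trans; cong; subst; isEquivalence)
open import Relation.Binary.Structures using (IsTotalOrder)
open import Relation.Nullary using (¬_; Dec; yes; no; does; ¬?; _×-dec_; _⊎-dec_; _→-dec_)
open import Relation.Nullary.Decidable using (from-yes; dec-true; dec-false; map′)

private
  variable
    n : ℕ

true≢false : true ≢ false
true≢false ()

≢-≢⇒≡ : {x y z : Bool} → x ≢ y → y ≢ z → x ≡ z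
≢-≢⇒≡ x≢y y≢z = trans (¬-not x≢y) (sym (¬-not (y≢z ∘ sym)))

true⊎false : (b : Bool) → b ≡ true ⊎ b ≡ false
true⊎false true  = inj₁ refl
true⊎false false = inj₂ refl

set : {P : Fin n → Set} → (∀ z → Dec (P z)) → Subset n
set P? z = does (P? z)

module _ {P : Fin n → Set} (P? : ∀ z → Dec (P z)) {z : Fin n} where

  ∈-set⁺ : P z → set P? z ≡ true
  ∈-set⁺ = dec-true (P? z)

  ∉-set⁺ : ¬ P z → set P? z ≡ false
  ∉-set⁺ = dec-false (P? z)

  ∈-set⁻ : set P? z ≡ true → P z
  ∈-set⁻ z∈ with P? z
  ... | yes Pz = Pz

  ∉-set⁻ : set P? z ≡ false → ¬ P z
  ∉-set⁻ z∉ Pz with P? z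
  ... | no ¬Pz = ¬Pz Pz

_⊆_ : Subset n → Subset n → Set
A ⊆ B = ∀ z → A z ≡ true → B z ≡ true

indicator : Bool → ℕ
indicator true  = 1
indicator false = 0

indicator-mono : {a b : Bool} → (a ≡ true → b ≡ true) → indicator a ≤ indicator b
indicator-mono {false} _ = z≤n
indicator-mono {true}  h rewrite h refl = s≤s z≤n

indicator≤1 : (a : Bool) → indicator a ≤ 1
indicator≤1 true  = s≤s z≤n
indicator≤1 false = z≤n

cons-if : {A : Set} → Bool → A → List A → List A
cons-if true  x xs = x ∷ xs
cons-if false x xs = xs

members : Subset n → List (Fin n)
members {zero}  A = []
members {suc n} A = cons-if (A zero) zero (map suc (members (A ∘ suc)))

size : Subset n → ℕ
size A = length (members A)

size-suc : (A : Subset (suc n)) → size A ≡ indicator (A zero) + size (A ∘ suc)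
size-suc A with A zero
... | true  = cong suc (length-map suc (members (A ∘ suc)))
... | false = length-map suc (members (A ∘ suc))

size-mono : {A B : Subset n} → A ⊆ B → size A ≤ size B
size-mono {zero}  _ = z≤n
size-mono {suc n} {A} {B} A⊆B rewrite size-suc A | size-suc B =
  ℕ.+-mono-≤ (indicator-mono (A⊆B zero)) (size-mono (A⊆B ∘ suc))

size-mono-< : {A B : Subset n} → A ⊆ B → ∀ u → B u ≡ true → A u ≡ false → size A < size B
size-mono-< {suc n} {A} {B} A⊆B zero Bu Au rewrite size-suc A | size-suc B | Bu | Au =
  s≤s (size-mono (A⊆B ∘ suc))
size-mono-< {suc n} {A} {B} A⊆B (suc u) Bu Au rewrite size-suc A | size-suc B =
  ℕ.+-mono-≤-< (indicator-mono (A⊆B zero)) (size-mono-< (A⊆B ∘ suc) u Bu Au)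

size-mono-except : {A B : Subset n} (u : Fin n) →
                   (∀ z → A z ≡ true → z ≢ u → B z ≡ true) → size A ≤ suc (size B)
size-mono-except {suc n} {A} {B} zero A⊆B rewrite size-suc A | size-suc B =
  ℕ.≤-trans (ℕ.+-mono-≤ (indicator≤1 (A zero)) (size-mono (λ z Az → A⊆B (suc z) Az λ ())))
            (s≤s (ℕ.m≤n+m _ (indicator (B zero))))
size-mono-except {suc n} {A} {B} (suc u) A⊆B rewrite size-suc A | size-suc B =
  ℕ.≤-trans (ℕ.+-mono-≤ (indicator-mono (λ A0 → A⊆B zero A0 λ ()))
                        (size-mono-except u (λ z Az z≢u → A⊆B (suc z) Az (z≢u ∘ suc-injective))))
            (ℕ.≤-reflexive (ℕ.+-suc (indicator (B zero)) _))

size-mono-except₂ : {A B : Subset n} (u u′ : Fin n) →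
                    (∀ z → A z ≡ true → z ≢ u → z ≢ u′ → B z ≡ true) → size A ≤ 2 + size B
size-mono-except₂ {A = A} {B} u u′ A⊆B =
  ℕ.≤-trans (size-mono-except {B = set A-u?} u λ z Az z≢u → ∈-set⁺ A-u? (Az , z≢u))
            (s≤s (size-mono-except u′ λ z z∈ z≢u′ → A⊆B z (proj₁ (∈-set⁻ A-u? z∈)) (proj₂ (∈-set⁻ A-u? z∈)) z≢u′))
  where
    A-u? : ∀ z → Dec (A z ≡ true × z ≢ u)
    A-u? z = (A z Bool.≟ true) ×-dec ¬? (z ≟ u)

∈-cons-if : {b : Bool} {xs : List (Fin (suc n))} {z : Fin (suc n)} →
            z ∈ cons-if b zero xs → (b ≡ true × z ≡ zero) ⊎ z ∈ xs
∈-cons-if {b = true}  (here refl) = inj₁ (refl , refl)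
∈-cons-if {b = true}  (there z∈)  = inj₂ z∈
∈-cons-if {b = false} z∈          = inj₂ z∈

∈-members⁻ : {A : Subset n} {z : Fin n} → z ∈ members A → A z ≡ true
∈-members⁻ {suc n} {A} z∈ with ∈-cons-if {b = A zero} z∈
... | inj₁ (A0 , refl) = A0
... | inj₂ z∈ with ∈-map⁻ suc z∈
...   | _ , z∈ , refl = ∈-members⁻ {A = A ∘ suc} z∈

∈-members⁺ : {A : Subset n} {z : Fin n} → A z ≡ true → z ∈ members A
∈-members⁺ {suc n} {A} {zero}  Az rewrite Az = here refl
∈-members⁺ {suc n} {A} {suc z} Az with A zero
... | true  = there (∈-map⁺ suc (∈-members⁺ {A = A ∘ suc} Az))
... | false = ∈-map⁺ suc (∈-members⁺ {A = A ∘ suc} Az)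

members-unique : (A : Subset n) → Unique (members A)
members-unique {zero}  A = []
members-unique {suc n} A with A zero
... | true  = AllP.map⁺ (All.universal (λ _ ()) _) ∷ Unique.map⁺ suc-injective (members-unique (A ∘ suc))
... | false = Unique.map⁺ suc-injective (members-unique (A ∘ suc))

module _ {a ℓ₁ ℓ₂} (O : TotalPreorder a ℓ₁ ℓ₂) where
  open TotalPreorder O using (total) renaming (Carrier to C; _≲_ to _≼_; refl to ≼-refl; trans to ≼-trans)

  least : (P : Subset n) (f : Fin n → C) → ∃ (λ a → P a ≡ true) →
          ∃ λ a → P a ≡ true × (∀ z → P z ≡ true → f a ≼ f z)
  least {suc n} P f (a , Pa) with any? (λ z → P (suc z) Bool.≟ true)
  least {suc n} P f (zero , P0)  | no none = zero , P0 , λ where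
    zero    _  → ≼-refl
    (suc z) Pz → ⊥-elim (none (z , Pz))
  least {suc n} P f (suc a , Pa) | no none = ⊥-elim (none (a , Pa))
  ... | yes tail with least (P ∘ suc) (f ∘ suc) tail | P zero Bool.≟ true
  ...   | m , Pm , m≼ | no ¬P0 = suc m , Pm , λ where
    zero    P0 → ⊥-elim (¬P0 P0)
    (suc z) Pz → m≼ z Pz
  ...   | m , Pm , m≼ | yes P0 with total (f zero) (f (suc m))
  ...     | inj₁ 0≼m = zero , P0 , λ where
    zero    _  → ≼-refl
    (suc z) Pz → ≼-trans 0≼m (m≼ z Pz)
  ...     | inj₂ m≼0 = suc m , Pm , λ where
    zero    _  → m≼0
    (suc z) Pz → m≼ z Pz

argmin : (P : Subset n) (f : Fin n → ℕ) → ∃ (λ a → P a ≡ true) →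
         ∃ λ a → P a ≡ true × (∀ z → P z ≡ true → f a ≤ f z)
argmin = least ℕ.≤-totalPreorder

argmax : (P : Subset n) (f : Fin n → ℕ) → ∃ (λ a → P a ≡ true) →
         ∃ λ a → P a ≡ true × (∀ z → P z ≡ true → f z ≤ f a)
argmax = least (Flip.totalPreorder ℕ.≤-totalPreorder)

module Distinct {A : Set} (_≟ᴬ_ : DecidableEquality A) where
  open DecMembership _≟ᴬ_ using (_∈?_)

  distinct : List A → ℕ
  distinct []       = 0
  distinct (x ∷ xs) with x ∈? xs
  ... | yes _ = distinct xs
  ... | no  _ = suc (distinct xs)

  distinct-∷ : ∀ x xs → distinct xs ≤ distinct (x ∷ xs)
  distinct-∷ x xs with x ∈? xs
  ... | yes _ = ℕ.≤-refl
  ... | no  _ = ℕ.n≤1+n _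

  distinct≤length : ∀ xs → distinct xs ≤ length xs
  distinct≤length []       = z≤n
  distinct≤length (x ∷ xs) with x ∈? xs
  ... | yes _ = ℕ.m≤n⇒m≤1+n (distinct≤length xs)
  ... | no  _ = s≤s (distinct≤length xs)

  distinct-map : ∀ (h : A → A) xs → distinct (map h xs) ≤ distinct xs
  distinct-map h []       = z≤n
  distinct-map h (x ∷ xs) with h x ∈? map h xs | x ∈? xs
  ... | yes _   | yes _ = distinct-map h xs
  ... | yes _   | no  _ = ℕ.m≤n⇒m≤1+n (distinct-map h xs)
  ... | no  h∉ | yes x∈ = ⊥-elim (h∉ (∈-map⁺ h x∈))
  ... | no  _   | no  _ = s≤s (distinct-map h xs)

  distinct-map-< : ∀ (h : A → A) xs {a b} → a ∈ xs → b ∈ xs → a ≢ b → h a ≡ h b →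
                   distinct (map h xs) < distinct xs
  distinct-map-< h (x ∷ xs) a∈ b∈ a≢b ha≡hb with h x ∈? map h xs | x ∈? xs
  distinct-map-< h (x ∷ xs) (here refl) (here refl) a≢b _ | _ | _ = ⊥-elim (a≢b refl)
  distinct-map-< h (x ∷ xs) (there a∈) (there b∈) a≢b ha≡hb | yes _ | yes _ =
    distinct-map-< h xs a∈ b∈ a≢b ha≡hb
  distinct-map-< h (x ∷ xs) (there a∈) (there b∈) a≢b ha≡hb | yes _ | no _ =
    ℕ.m≤n⇒m≤1+n (distinct-map-< h xs a∈ b∈ a≢b ha≡hb)
  distinct-map-< h (x ∷ xs) (there a∈) (there b∈) a≢b ha≡hb | no h∉ | yes x∈ = ⊥-elim (h∉ (∈-map⁺ h x∈))
  distinct-map-< h (x ∷ xs) (there a∈) (there b∈) a≢b ha≡hb | no _ | no _ =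
    s≤s (distinct-map-< h xs a∈ b∈ a≢b ha≡hb)
  distinct-map-< h (x ∷ xs) (here refl) (there b∈) a≢b ha≡hb | no h∉ | _ =
    ⊥-elim (h∉ (subst (_∈ map h xs) (sym ha≡hb) (∈-map⁺ h b∈)))
  distinct-map-< h (x ∷ xs) (here refl) (there b∈) a≢b ha≡hb | yes _ | no _ = s≤s (distinct-map h xs)
  distinct-map-< h (x ∷ xs) (here refl) (there b∈) a≢b ha≡hb | yes _ | yes x∈ =
    distinct-map-< h xs x∈ b∈ a≢b ha≡hb
  distinct-map-< h (x ∷ xs) (there a∈) (here refl) a≢b ha≡hb | no h∉ | _ =
    ⊥-elim (h∉ (subst (_∈ map h xs) ha≡hb (∈-map⁺ h a∈)))
  distinct-map-< h (x ∷ xs) (there a∈) (here refl) a≢b ha≡hb | yes _ | no _ = s≤s (distinct-map h xs)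
  distinct-map-< h (x ∷ xs) (there a∈) (here refl) a≢b ha≡hb | yes _ | yes x∈ =
    distinct-map-< h xs a∈ x∈ a≢b ha≡hb

  remove : A → List A → List A
  remove y []       = []
  remove y (x ∷ xs) with x ≟ᴬ y
  ... | yes _ = remove y xs
  ... | no  _ = x ∷ remove y xs

  ∈-remove⁻ : ∀ {y z} xs → z ∈ remove y xs → z ∈ xs
  ∈-remove⁻ {y} (x ∷ xs) z∈ with x ≟ᴬ y
  ∈-remove⁻ {y} (x ∷ xs) z∈          | yes _ = there (∈-remove⁻ xs z∈)
  ∈-remove⁻ {y} (x ∷ xs) (here z≡x)  | no  _ = here z≡x
  ∈-remove⁻ {y} (x ∷ xs) (there z∈)  | no  _ = there (∈-remove⁻ xs z∈)

  ∈-remove⁺ : ∀ {y z} xs → z ∈ xs → z ≢ y → z ∈ remove y xs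
  ∈-remove⁺ {y} (x ∷ xs) z∈ z≢y with x ≟ᴬ y
  ∈-remove⁺ {y} (x ∷ xs) (here refl) z≢y | yes x≡y = ⊥-elim (z≢y x≡y)
  ∈-remove⁺ {y} (x ∷ xs) (there z∈)  z≢y | yes _   = ∈-remove⁺ xs z∈ z≢y
  ∈-remove⁺ {y} (x ∷ xs) (here z≡x)  z≢y | no  _   = here z≡x
  ∈-remove⁺ {y} (x ∷ xs) (there z∈)  z≢y | no  _   = there (∈-remove⁺ xs z∈ z≢y)

  distinct-remove : ∀ y xs → distinct (remove y xs) ≤ distinct xs
  distinct-remove y []       = z≤n
  distinct-remove y (x ∷ xs) with x ≟ᴬ y
  ... | yes _ = ℕ.≤-trans (distinct-remove y xs) (distinct-∷ x xs)
  ... | no x≢y with x ∈? remove y xs | x ∈? xs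
  ...   | yes _  | yes _  = distinct-remove y xs
  ...   | yes x∈ | no x∉ = ⊥-elim (x∉ (∈-remove⁻ xs x∈))
  ...   | no x∉ | yes x∈ = ⊥-elim (x∉ (∈-remove⁺ xs x∈ x≢y))
  ...   | no _   | no _   = s≤s (distinct-remove y xs)

  distinct-remove-< : ∀ {y} xs → y ∈ xs → distinct (remove y xs) < distinct xs
  distinct-remove-< {y} (x ∷ xs) y∈ with x ≟ᴬ y
  distinct-remove-< {y} (x ∷ xs) y∈ | yes refl with x ∈? xs
  ... | yes x∈ = distinct-remove-< xs x∈
  ... | no  _  = s≤s (distinct-remove x xs)
  distinct-remove-< {y} (x ∷ xs) (here refl) | no x≢y = ⊥-elim (x≢y refl)
  distinct-remove-< {y} (x ∷ xs) (there y∈)  | no x≢y with x ∈? remove y xs | x ∈? xs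
  ... | yes _  | yes _  = distinct-remove-< xs y∈
  ... | yes x∈ | no x∉ = ⊥-elim (x∉ (∈-remove⁻ xs x∈))
  ... | no x∉ | yes x∈ = ⊥-elim (x∉ (∈-remove⁺ xs x∈ x≢y))
  ... | no _   | no _   = s≤s (distinct-remove-< xs y∈)

  length≤distinct : ∀ {ys} xs → AllPairs _≢_ ys → All (_∈ xs) ys → length ys ≤ distinct xs
  length≤distinct xs [] [] = z≤n
  length≤distinct {y ∷ ys} xs (y≢ys ∷ ys-distinct) (y∈ ∷ ys⊆) =
    ℕ.≤-trans (s≤s (length≤distinct (remove y xs) ys-distinct (still-in ys y≢ys ys⊆)))
              (distinct-remove-< xs y∈)
    where
      still-in : ∀ zs → All (y ≢_) zs → All (_∈ xs) zs → All (_∈ remove y xs) zs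
      still-in []       []           []           = []
      still-in (z ∷ zs) (y≢z ∷ y≢zs) (z∈ ∷ zs⊆) = ∈-remove⁺ xs z∈ (y≢z ∘ sym) ∷ still-in zs y≢zs zs⊆

DiffersOnlyAt : {A : Set} → (Fin n → A) → (Fin n → A) → Fin n → Set
DiffersOnlyAt f g l = f l ≢ g l × (∀ i → i ≢ l → f i ≡ g i)

DiffersOnlyAt-sym : {A : Set} {f g : Fin n → A} {l : Fin n} → DiffersOnlyAt f g l → DiffersOnlyAt g f l
DiffersOnlyAt-sym (fl≢gl , f≗g) = fl≢gl ∘ sym , λ i i≢l → sym (f≗g i i≢l)

differsOnlyAt? : (f g : Fin n → Bool) (l : Fin n) → Dec (DiffersOnlyAt f g l)
differsOnlyAt? f g l = ¬? (f l Bool.≟ g l) ×-dec all? λ i → ¬? (i ≟ l) →-dec (f i Bool.≟ g i)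

vec-ext : {u w : Vec Bool n} → (∀ i → lookup u i ≡ lookup w i) → u ≡ w
vec-ext {u = u} {w} u≗w = trans (sym (tabulate∘lookup u)) (trans (tabulate-cong u≗w) (tabulate∘lookup w))

clear : Fin n → Vec Bool n → Vec Bool n
clear l v = v [ l ]≔ false

clearAll : List (Fin n) → Vec Bool n → Vec Bool n
clearAll []      v = v
clearAll (l ∷ L) v = clearAll L (clear l v)

lookup-clearAll : (L : List (Fin n)) (v : Vec Bool n) {c : Fin n} → ¬ c ∈ L → lookup (clearAll L v) c ≡ lookup v c
lookup-clearAll []      v c∉ = refl
lookup-clearAll (l ∷ L) v c∉ =
  trans (lookup-clearAll L (clear l v) (c∉ ∘ there)) (lookup∘update′ (c∉ ∘ here) v false)

clear-merges : {u w : Vec Bool n} {l : Fin n} → DiffersOnlyAt (lookup u) (lookup w) l → clear l u ≡ clear l w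
clear-merges {u = u} {w} {l} (_ , u≗w) = vec-ext same
  where
    same : ∀ i → lookup (clear l u) i ≡ lookup (clear l w) i
    same i with i ≟ l
    ... | yes refl = trans (lookup∘update l u false) (sym (lookup∘update l w false))
    ... | no i≢l   = trans (lookup∘update′ i≢l u false) (trans (u≗w i i≢l) (sym (lookup∘update′ i≢l w false)))

clear-DiffersOnlyAt : {u w : Vec Bool n} {l l′ : Fin n} → DiffersOnlyAt (lookup u) (lookup w) l′ → l ≢ l′ →
                      DiffersOnlyAt (lookup (clear l u)) (lookup (clear l w)) l′
clear-DiffersOnlyAt {u = u} {w} {l} {l′} (ul′≢wl′ , u≗w) l≢l′ =
  (λ e → ul′≢wl′ (trans (sym (unchanged u l′≢l)) (trans e (unchanged w l′≢l)))) , agree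
  where
    l′≢l : l′ ≢ l
    l′≢l = l≢l′ ∘ sym
    unchanged : ∀ v {i} → i ≢ l → lookup (clear l v) i ≡ lookup v i
    unchanged v i≢l = lookup∘update′ i≢l v false
    agree : ∀ i → i ≢ l′ → lookup (clear l u) i ≡ lookup (clear l w) i
    agree i i≢l′ with i ≟ l
    ... | yes refl = trans (lookup∘update l u false) (sym (lookup∘update l w false))
    ... | no i≢l   = trans (unchanged u i≢l) (trans (u≗w i i≢l′) (sym (unchanged w i≢l)))

HasPairDifferingOnlyAt : List (Vec Bool n) → Fin n → Set
HasPairDifferingOnlyAt ps l = ∃ λ u → ∃ λ w → u ∈ ps × w ∈ ps × DiffersOnlyAt (lookup u) (lookup w) l

_≟ᵛ_ : DecidableEquality (Vec Bool n)
_≟ᵛ_ = ≡-dec Bool._≟_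

open module DistinctVec {n} = Distinct (_≟ᵛ_ {n}) using (distinct; distinct≤length; distinct-map-<; length≤distinct)

-- Clearing a coordinate on which two of the vectors differ, and only there, merges them.
distinct-clearAll : (L : List (Fin n)) → Unique L → (ps : List (Vec Bool n)) →
                    All (HasPairDifferingOnlyAt ps) L → length L + distinct (map (clearAll L) ps) ≤ distinct ps
distinct-clearAll []      _            ps []         = ℕ.≤-reflexive (cong distinct (map-id ps))
distinct-clearAll (l ∷ L) (l∉L ∷ L-unique) ps ((u , w , u∈ , w∈ , u~w) ∷ pairs) =
  ℕ.≤-trans (s≤s (ℕ.≤-trans (ℕ.≤-reflexive (cong (λ qs → length L + distinct qs) (map-∘ ps))) ih))
            (distinct-map-< (clear l) ps u∈ w∈ (λ { refl → proj₁ u~w refl }) (clear-merges u~w))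
  where
    still-paired : ∀ {K} → All (l ≢_) K → All (HasPairDifferingOnlyAt ps) K →
                   All (HasPairDifferingOnlyAt (map (clear l) ps)) K
    still-paired []           []                                   = []
    still-paired (l≢k ∷ l≢K) ((u′ , w′ , u′∈ , w′∈ , d) ∷ pairs′) =
      (clear l u′ , clear l w′ , ∈-map⁺ (clear l) u′∈ , ∈-map⁺ (clear l) w′∈ , clear-DiffersOnlyAt {u = u′} {w′} d l≢k)
      ∷ still-paired l≢K pairs′
    ih : length L + distinct (map (clearAll L) (map (clear l) ps)) ≤ distinct (map (clear l) ps)
    ih = distinct-clearAll L L-unique (map (clear l) ps) (still-paired l∉L pairs)

coordinate-bound : (L : List (Fin n)) → Unique L → (ps : List (Vec Bool n)) → All (HasPairDifferingOnlyAt ps) L →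
                   (qs : List (Vec Bool n)) → AllPairs _≢_ qs → All (_∈ map (clearAll L) ps) qs →
                   length L + length qs ≤ length ps
coordinate-bound L L-unique ps pairs qs qs-distinct qs⊆ =
  ℕ.≤-trans (ℕ.+-monoʳ-≤ (length L) (length≤distinct _ qs-distinct qs⊆))
            (ℕ.≤-trans (distinct-clearAll L L-unique ps pairs) (distinct≤length ps))

avoid-two : 3 ≤ n → (a b : Fin n) → ∃ λ c → c ≢ a × c ≢ b
avoid-two {suc zero}       (s≤s ())
avoid-two {suc (suc zero)} (s≤s (s≤s ()))
avoid-two {suc (suc (suc _))} _ a b with a ≟ zero | b ≟ zero
... | no a≢0   | no b≢0 = zero , (a≢0 ∘ sym) , (b≢0 ∘ sym)
... | yes refl | yes refl = suc zero , (λ ()) , (λ ())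
... | yes refl | no b≢0 with b ≟ suc zero
...   | yes refl = suc (suc zero) , (λ ()) , (λ ())
...   | no b≢1   = suc zero , (λ ()) , (b≢1 ∘ sym)
avoid-two {suc (suc (suc _))} _ a b | no a≢0 | yes refl with a ≟ suc zero
...   | yes refl = suc (suc zero) , (λ ()) , (λ ())
...   | no a≢1   = suc zero , (a≢1 ∘ sym) , (λ ())

Nontrivial : Subset n → Set
Nontrivial M = ∃ λ a → ∃ λ a′ → ∃ λ c → M a ≡ true × M a′ ≡ true × a ≢ a′ × M c ≡ false

trivial⊎nontrivial : (M : Subset n) → IsTrivialModule M ⊎ Nontrivial M
trivial⊎nontrivial {n} M with all? (λ v → M v Bool.≟ false)
... | yes empty = inj₁ (inj₁ empty)
... | no ¬empty with ¬∀⟶∃¬ n _ (λ v → M v Bool.≟ false) ¬empty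
...   | a , Ma≢false with all? (λ v → M v Bool.≟ true)
...     | yes full = inj₁ (inj₂ (inj₁ full))
...     | no ¬full with ¬∀⟶∃¬ n _ (λ v → M v Bool.≟ true) ¬full
...       | c , Mc≢true with any? (λ v → (M v Bool.≟ true) ×-dec ¬? (v ≟ a))
...         | yes (a′ , Ma′ , a′≢a) = inj₂ (a , a′ , c , ¬-not Ma≢false , Ma′ , a′≢a ∘ sym , ¬-not Mc≢true)
...         | no ¬other = inj₁ (inj₂ (inj₂ (a , λ v → only-a v , λ { refl → ¬-not Ma≢false })))
  where
    only-a : ∀ v → M v ≡ true → v ≡ a
    only-a v Mv with v ≟ a
    ... | yes v≡a = v≡a
    ... | no v≢a  = ⊥-elim (¬other (v , Mv , v≢a))

trivial⇒¬nontrivial : {M : Subset n} → IsTrivialModule M → ¬ Nontrivial M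
trivial⇒¬nontrivial (inj₁ empty)               (a , _ , _ , Ma , _) = true≢false (trans (sym Ma) (empty a))
trivial⇒¬nontrivial (inj₂ (inj₁ full))         (_ , _ , c , _ , _ , _ , Mc) = true≢false (trans (sym (full c)) Mc)
trivial⇒¬nontrivial (inj₂ (inj₂ (_ , single))) (a , a′ , _ , Ma , Ma′ , a≢a′ , _) =
  a≢a′ (trans (proj₁ (single a) Ma) (sym (proj₁ (single a′) Ma′)))

module _ (G : Graph n) where

  NoEdgeOut : Subset n → Set
  NoEdgeOut S = ∀ s r → S s ≡ true → S r ≡ false → adj G s r ≡ false

  prime⇒no-nontrivial-module : Prime G → {M : Subset n} → IsModule G M → ¬ Nontrivial M
  prime⇒no-nontrivial-module (_ , trivial) {M} M-module = trivial⇒¬nontrivial (trivial M M-module)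

  noEdgeOut⇒module : {S : Subset n} → NoEdgeOut S → IsModule G S
  noEdgeOut⇒module closed v Sv a b Sa Sb =
    trans (adj-sym G v a) (trans (closed a v Sa Sv) (sym (trans (adj-sym G v b) (closed b v Sb Sv))))

  prime⇒connected : Prime G → {S : Subset n} → NoEdgeOut S → ∀ {a b} → S a ≡ true → S b ≡ false → ⊥
  prime⇒connected pG {S} closed {a} {b} Sa Sb with trivial⊎nontrivial S
  ... | inj₂ nontrivial = prime⇒no-nontrivial-module pG (noEdgeOut⇒module closed) nontrivial
  ... | inj₁ (inj₁ empty)       = true≢false (trans (sym Sa) (empty a))
  ... | inj₁ (inj₂ (inj₁ full)) = true≢false (trans (sym (full b)) Sb)
  ... | inj₁ (inj₂ (inj₂ (s , single))) with avoid-two (proj₁ pG) a b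
  ...   | c , c≢a , c≢b =
    prime⇒no-nontrivial-module pG (noEdgeOut⇒module co-closed)
      (b , c , a , cong not Sb , cong not Sc , c≢b ∘ sym , cong not Sa)
    where
      Sc : S c ≡ false
      Sc = ¬-not (λ Sc → c≢a (trans (proj₁ (single c) Sc) (sym (proj₁ (single a) Sa))))
      co-closed : NoEdgeOut (not ∘ S)
      co-closed s r ¬Ss ¬Sr = trans (adj-sym G s r) (closed r s (Bool.not-injective ¬Sr) (Bool.not-injective ¬Ss))

  prime⇒has-neighbour : Prime G → ∀ a → ∃ λ z → adj G a z ≡ true
  prime⇒has-neighbour pG a with any? (λ z → adj G a z Bool.≟ true)
  ... | yes found = found
  ... | no none with avoid-two (proj₁ pG) a a
  ...   | c , c≢a , _ = ⊥-elim (prime⇒connected pG closed {a} {c} (∈-set⁺ (_≟ a) refl) (∉-set⁺ (_≟ a) c≢a))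
    where
      closed : NoEdgeOut (set (_≟ a))
      closed s r s∈ _ with ∈-set⁻ (_≟ a) {s} s∈
      ... | refl = ¬-not (λ ar → none (r , ar))

  prime⇒no-twins : Prime G → ∀ {a b} → a ≢ b → (∀ z → z ≢ a → z ≢ b → adj G z a ≡ adj G z b) → ⊥
  prime⇒no-twins pG {a} {b} a≢b twins with avoid-two (proj₁ pG) a b
  ... | c , c≢a , c≢b = prime⇒no-nontrivial-module pG pair-module
                          (a , b , c , ∈-set⁺ pair? (inj₁ refl) , ∈-set⁺ pair? (inj₂ refl) , a≢b ,
                           ∉-set⁺ pair? [ c≢a , c≢b ])
    where
      pair? : ∀ z → Dec (z ≡ a ⊎ z ≡ b)
      pair? z = (z ≟ a) ⊎-dec (z ≟ b)
      pair-module : IsModule G (set pair?)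
      pair-module v v∉ p q p∈ q∈ with ∉-set⁻ pair? {v} v∉ | ∈-set⁻ pair? {p} p∈ | ∈-set⁻ pair? {q} q∈
      ... | _     | inj₁ refl | inj₁ refl = refl
      ... | _     | inj₂ refl | inj₂ refl = refl
      ... | v∉a,b | inj₁ refl | inj₂ refl = twins v (v∉a,b ∘ inj₁) (v∉a,b ∘ inj₂)
      ... | v∉a,b | inj₂ refl | inj₁ refl = sym (twins v (v∉a,b ∘ inj₁) (v∉a,b ∘ inj₂))

  distinguisher∈module : {M : Subset n} → IsModule G M → ∀ {p q z} → M p ≡ true → M q ≡ true →
                         adj G z p ≢ adj G z q → M z ≡ true
  distinguisher∈module M-module {p} {q} {z} Mp Mq zp≢zq = ¬-not λ Mz → zp≢zq (M-module z Mz p q Mp Mq)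

  prime⇒neighbourhood-injective : Prime G → ∀ {a b} → (∀ z → adj G a z ≡ adj G b z) → a ≡ b
  prime⇒neighbourhood-injective pG {a} {b} a≗b with a ≟ b
  ... | yes a≡b = a≡b
  ... | no a≢b  = ⊥-elim (prime⇒no-twins pG a≢b λ z _ _ → trans (adj-sym G z a) (trans (a≗b z) (adj-sym G b z)))

  prime⇒distinguishing : Prime G → ∀ {a b} → a ≢ b → ∃ λ u → adj G u a ≢ adj G u b
  prime⇒distinguishing pG {a} {b} a≢b with any? (λ u → ¬? (adj G u a Bool.≟ adj G u b))
  ... | yes found = found
  ... | no none = ⊥-elim (prime⇒no-twins pG a≢b λ u _ _ → agree u)
    where
      agree : ∀ u → adj G u a ≡ adj G u b
      agree u with adj G u a Bool.≟ adj G u b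
      ... | yes e = e
      ... | no ne = ⊥-elim (none (u , ne))

RowsDistinct : {k : ℕ} → Graph k → Set
RowsDistinct {k} H = ∀ i j → i ≢ j → ∃ λ l → adj H i l ≢ adj H j l

P5-rows-equal-or-differ : Dec (∀ i j → i ≡ j ⊎ ∃ λ l → adj P5 i l ≢ adj P5 j l)
P5-rows-equal-or-differ = all? λ i → all? λ j → (i ≟ j) ⊎-dec any? λ l → ¬? (adj P5 i l Bool.≟ adj P5 j l)

P5-rows-distinct : RowsDistinct P5
P5-rows-distinct i j i≢j with from-yes P5-rows-equal-or-differ i j
... | inj₁ i≡j = ⊥-elim (i≢j i≡j)
... | inj₂ differ = differ

module _ (G : Graph n) where

  induced-copy : {k : ℕ} (H : Graph k) → RowsDistinct H → (f : Fin k → Fin n) →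
                 (∀ i j → i Fin.< j → adj G (f i) (f j) ≡ adj H i j) → HasInducedCopy H G
  induced-copy H rows f upper = f , injective , preserves
    where
      preserves : ∀ i j → adj G (f i) (f j) ≡ adj H i j
      preserves i j with <-cmp i j
      ... | tri< i<j _ _ = upper i j i<j
      ... | tri≈ _ refl _ = trans (irrefl G (f i)) (sym (irrefl H i))
      ... | tri> _ _ j<i = trans (adj-sym G (f i) (f j)) (trans (upper j i j<i) (adj-sym H j i))
      injective : ∀ {i j} → f i ≡ f j → i ≡ j
      injective {i} {j} fi≡fj with i ≟ j
      ... | yes i≡j = i≡j
      ... | no i≢j with rows i j i≢j
      ...   | l , differ = ⊥-elim (differ (trans (sym (preserves i l))
                                            (trans (cong (λ x → adj G x (f l)) fi≡fj) (preserves j l))))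

  induced-P5 : ∀ f0 f1 f2 f3 f4 →
               adj G f0 f1 ≡ true → adj G f1 f2 ≡ true → adj G f2 f3 ≡ true → adj G f3 f4 ≡ true →
               adj G f0 f2 ≡ false → adj G f0 f3 ≡ false → adj G f0 f4 ≡ false →
               adj G f1 f3 ≡ false → adj G f1 f4 ≡ false → adj G f2 f4 ≡ false → HasInducedCopy P5 G
  induced-P5 f0 f1 f2 f3 f4 e01 e12 e23 e34 n02 n03 n04 n13 n14 n24 =
    induced-copy P5 P5-rows-distinct f upper
    where
      f : Fin 5 → Fin n
      f = lookup (f0 Vec.∷ f1 Vec.∷ f2 Vec.∷ f3 Vec.∷ f4 Vec.∷ Vec.[])
      upper : ∀ i j → i Fin.< j → adj G (f i) (f j) ≡ adj P5 i j
      upper zero (suc zero) _ = e01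
      upper zero (suc (suc zero)) _ = n02
      upper zero (suc (suc (suc zero))) _ = n03
      upper zero (suc (suc (suc (suc zero)))) _ = n04
      upper (suc zero) (suc (suc zero)) _ = e12
      upper (suc zero) (suc (suc (suc zero))) _ = n13
      upper (suc zero) (suc (suc (suc (suc zero)))) _ = n14
      upper (suc (suc zero)) (suc (suc (suc zero))) _ = e23
      upper (suc (suc zero)) (suc (suc (suc (suc zero)))) _ = n24
      upper (suc (suc (suc zero))) (suc (suc (suc (suc zero)))) _ = e34
      upper zero zero ()
      upper (suc _) zero ()
      upper (suc zero) (suc zero) (s≤s ())
      upper (suc (suc _)) (suc zero) (s≤s ())
      upper (suc (suc zero)) (suc (suc zero)) (s≤s (s≤s ()))
      upper (suc (suc (suc _))) (suc (suc zero)) (s≤s (s≤s ()))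
      upper (suc (suc (suc zero))) (suc (suc (suc zero))) (s≤s (s≤s (s≤s ())))
      upper (suc (suc (suc (suc _)))) (suc (suc (suc zero))) (s≤s (s≤s (s≤s ())))
      upper (suc (suc (suc (suc zero)))) (suc (suc (suc (suc zero)))) (s≤s (s≤s (s≤s (s≤s ()))))

part-≡ : {side : Fin n → Bool} {b : Bool} {x y : Part side b} → proj₁ x ≡ proj₁ y → x ≡ y
part-≡ {x = _ , refl} {y = _ , refl} refl = refl

module Bipartite (G : Graph n) (side : Fin n → Bool) (bip : IsBipartition G side) where

  infix 5 _∼_
  _∼_ : Fin n → Fin n → Bool
  _∼_ = adj G

  ∼-sym : ∀ u v → u ∼ v ≡ v ∼ u
  ∼-sym = adj-sym G

  ∼-flip : ∀ {u v b} → u ∼ v ≡ b → v ∼ u ≡ b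
  ∼-flip {u} {v} uv = trans (∼-sym v u) uv

  same-side⇒≁ : ∀ {u v} → side u ≡ side v → u ∼ v ≡ false
  same-side⇒≁ {u} {v} same = ¬-not (λ uv → bip u v uv same)

  ∼⇒other-side : ∀ {u v} → u ∼ v ≡ true → side u ≢ side v
  ∼⇒other-side {u} {v} = bip u v

  X∼⇒Y : ∀ {u v} → side u ≡ false → u ∼ v ≡ true → side v ≡ true
  X∼⇒Y u∈X uv = ¬-not (∼⇒other-side uv ∘ trans u∈X ∘ sym)

  Y∼⇒X : ∀ {u v} → side u ≡ true → u ∼ v ≡ true → side v ≡ false
  Y∼⇒X u∈Y uv = ¬-not (∼⇒other-side uv ∘ trans u∈Y ∘ sym)

  ∼∼⇒same-side : ∀ {u v w} → u ∼ v ≡ true → v ∼ w ≡ true → side u ≡ side w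
  ∼∼⇒same-side uv vw = ≢-≢⇒≡ (∼⇒other-side uv) (∼⇒other-side vw)

  ∼⇒≢ : ∀ {u v} → u ∼ v ≡ true → u ≢ v
  ∼⇒≢ {u} uu refl = true≢false (trans (sym uu) (irrefl G u))

  ∅ : Subset n
  ∅ _ = false

  nbhd : Maybe (Fin n) → Subset n
  nbhd nothing  = ∅
  nbhd (just b) = b ∼_

  -- Deleting v leaves the vertex a isolated (b = nothing) or makes a and b twins.
  Witness : Fin n → Set
  Witness v = ∃ λ a → ∃ λ b → DiffersOnlyAt (a ∼_) (nbhd b) v

  Pendant : Fin n → Set
  Pendant v = ∃ λ a → DiffersOnlyAt (a ∼_) ∅ v

  witness? : ∀ v → Dec (Witness v)
  witness? v = map′ from to ((any? λ a → differsOnlyAt? (a ∼_) ∅ v) ⊎-dec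
                             (any? λ a → any? λ b → differsOnlyAt? (a ∼_) (b ∼_) v))
    where
      from : (∃ λ a → DiffersOnlyAt (a ∼_) ∅ v) ⊎ (∃ λ a → ∃ λ b → DiffersOnlyAt (a ∼_) (b ∼_) v) → Witness v
      from (inj₁ (a , d))     = a , nothing , d
      from (inj₂ (a , b , d)) = a , just b , d
      to : Witness v → (∃ λ a → DiffersOnlyAt (a ∼_) ∅ v) ⊎ (∃ λ a → ∃ λ b → DiffersOnlyAt (a ∼_) (b ∼_) v)
      to (a , nothing , d) = inj₁ (a , d)
      to (a , just b , d)  = inj₂ (a , b , d)

  witness-≢ : ∀ {a b v} → DiffersOnlyAt (a ∼_) (nbhd b) v → a ≢ v
  witness-≢ {a} {nothing} (av≢ , _) refl = av≢ (irrefl G a)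
  witness-≢ {a} {just b}  (av≢ , agree) refl =
    true≢false (trans (sym (∼-flip bv)) (trans (agree b (∼⇒≢ bv)) (irrefl G b)))
    where
      bv : b ∼ a ≡ true
      bv = ¬-not (av≢ ∘ trans (irrefl G a) ∘ sym)

  NoEdgeOutExcept : Fin n → Subset n → Set
  NoEdgeOutExcept v S = ∀ s r → S s ≡ true → S r ≡ false → r ≢ v → s ∼ r ≡ false

  CutSide : Fin n → Subset n → Set
  CutSide v S = S v ≡ false × (∃ λ s → S s ≡ true) × (∃ λ r → r ≢ v × S r ≡ false) × NoEdgeOutExcept v S

  CutVertex : Fin n → Set
  CutVertex v = ∃ (CutSide v)

  N[_]⊆N[_] : Fin n → Fin n → Set
  N[ a ]⊆N[ b ] = (a ∼_) ⊆ (b ∼_)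

  ⊆N? : ∀ a b → Dec N[ a ]⊆N[ b ]
  ⊆N? a b = all? λ z → (a ∼ z Bool.≟ true) →-dec (b ∼ z Bool.≟ true)

  ⊈N⇒private-neighbour : ∀ {a b} → ¬ N[ a ]⊆N[ b ] → ∃ λ z → a ∼ z ≡ true × b ∼ z ≡ false
  ⊈N⇒private-neighbour {a} {b} a⊈b with any? (λ z → (a ∼ z Bool.≟ true) ×-dec (b ∼ z Bool.≟ false))
  ... | yes (z , az , bz) = z , az , bz
  ... | no none = ⊥-elim (a⊈b λ z az → ¬-not λ bz → none (z , az , bz))

  ⊆N-antisym : ∀ {a b} → N[ a ]⊆N[ b ] → N[ b ]⊆N[ a ] → ∀ z → a ∼ z ≡ b ∼ z
  ⊆N-antisym {a} {b} a⊆b b⊆a z with true⊎false (a ∼ z) | true⊎false (b ∼ z)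
  ... | inj₁ az | _       = trans az (sym (a⊆b z az))
  ... | inj₂ az | inj₁ bz = ⊥-elim (true≢false (trans (sym (b⊆a z bz)) az))
  ... | inj₂ az | inj₂ bz = trans az (sym bz)

  deg : Fin n → ℕ
  deg a = size (a ∼_)

  deg-mono-< : ∀ {a b z} → N[ a ]⊆N[ b ] → b ∼ z ≡ true → a ∼ z ≡ false → deg a < deg b
  deg-mono-< {z = z} a⊆b bz az = size-mono-< a⊆b z bz az

  2K₂-Free : Set
  2K₂-Free = ∀ a b c d → side a ≡ side c → a ∼ b ≡ true → c ∼ d ≡ true → a ∼ d ≡ false → c ∼ b ≡ false → ⊥

  2K₂-free⇒nested : 2K₂-Free → ∀ {a c} → side a ≡ side c → N[ a ]⊆N[ c ] ⊎ N[ c ]⊆N[ a ]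
  2K₂-free⇒nested free {a} {c} same with ⊆N? a c
  ... | yes a⊆c = inj₁ a⊆c
  ... | no a⊈c with ⊈N⇒private-neighbour a⊈c
  ...   | b , ab , cb = inj₂ λ d cd → ¬-not λ ad → free a b c d same ab cd ad cb

  2K₂-free⇒deg-⊆ : 2K₂-Free → ∀ {a b} → side a ≡ side b → deg a ≤ deg b → N[ a ]⊆N[ b ]
  2K₂-free⇒deg-⊆ free {a} {b} same deg≤ with ⊆N? a b
  ... | yes a⊆b = a⊆b
  ... | no a⊈b with ⊈N⇒private-neighbour a⊈b | 2K₂-free⇒nested free same
  ...   | _ , _ , _   | inj₁ a⊆b = ⊥-elim (a⊈b a⊆b)
  ...   | z , az , bz | inj₂ b⊆a = ⊥-elim (ℕ.<⇒≱ (deg-mono-< b⊆a az bz) deg≤)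

  2K₂-free⇒P5-free : 2K₂-Free → ¬ HasInducedCopy P5 G
  2K₂-free⇒P5-free free (f , _ , path) =
    free (f (# 0)) (f (# 1)) (f (# 4)) (f (# 3)) ends-same-side
         (path (# 0) (# 1)) (path (# 4) (# 3)) (path (# 0) (# 3)) (path (# 4) (# 1))
    where
      ends-same-side : side (f (# 0)) ≡ side (f (# 4))
      ends-same-side = trans (∼∼⇒same-side (path (# 0) (# 1)) (path (# 1) (# 2)))
                             (∼∼⇒same-side (path (# 2) (# 3)) (path (# 3) (# 4)))

  bipartite-P5 : ∀ {x y r s t} → x ∼ y ≡ true → y ∼ r ≡ true → r ∼ s ≡ true → s ∼ t ≡ true →
                 x ∼ s ≡ false → x ∼ t ≡ false → y ∼ s ≡ false → y ∼ t ≡ false → HasInducedCopy P5 G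
  bipartite-P5 {x} {y} {r} {s} {t} xy yr rs st xs xt ys yt =
    induced-P5 G x y r s t xy yr rs st (same-side⇒≁ (∼∼⇒same-side xy yr)) xs xt ys yt
               (same-side⇒≁ (∼∼⇒same-side rs st))

  -- For a 2K₂ ab, cd: the vertices adjacent to neither a nor b and with a neighbour of the same kind contain c
  -- but not a, and no edge leaves them, since such an edge would start an induced P5 through a or b.
  prime∧P5-free⇒2K₂-free : Prime G → ¬ HasInducedCopy P5 G → 2K₂-Free
  prime∧P5-free⇒2K₂-free pG P5-free a b c d same ab cd ad cb =
    prime⇒connected G pG {set linked?} closed {c} {a} (∈-set⁺ linked? c-linked) (∉-set⁺ linked? a-unlinked)
    where
      Far : Fin n → Set
      Far z = a ∼ z ≡ false × b ∼ z ≡ false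
      far? : ∀ z → Dec (Far z)
      far? z = (a ∼ z Bool.≟ false) ×-dec (b ∼ z Bool.≟ false)
      Linked : Fin n → Set
      Linked u = Far u × ∃ λ t → Far t × u ∼ t ≡ true
      linked? : ∀ u → Dec (Linked u)
      linked? u = far? u ×-dec any? λ t → far? t ×-dec (u ∼ t Bool.≟ true)
      c-linked : Linked c
      c-linked = (same-side⇒≁ same , ∼-flip cb) , d , (ad , same-side⇒≁ b-d-same-side) , cd
        where
          b-d-same-side : side b ≡ side d
          b-d-same-side = ≢-≢⇒≡ (∼⇒other-side (∼-flip ab)) (λ a≡d → ∼⇒other-side cd (trans (sym same) a≡d))
      a-unlinked : ¬ Linked a
      a-unlinked ((_ , ba) , _) = true≢false (trans (sym (∼-flip ab)) ba)
      escape : ∀ {s r} → Linked s → ¬ Linked r → s ∼ r ≡ true → ⊥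
      escape {s} {r} (far-s , t , far-t , st) unlinked-r sr with far? r
      ... | yes far-r = unlinked-r (far-r , s , far-s , ∼-flip sr)
      ... | no near-r with true⊎false (a ∼ r) | true⊎false (b ∼ r)
      ...   | inj₁ ar | _       =
        P5-free (bipartite-P5 (∼-flip ab) ar (∼-flip sr) st (proj₂ far-s) (proj₂ far-t) (proj₁ far-s) (proj₁ far-t))
      ...   | inj₂ _  | inj₁ br =
        P5-free (bipartite-P5 ab br (∼-flip sr) st (proj₁ far-s) (proj₁ far-t) (proj₂ far-s) (proj₂ far-t))
      ...   | inj₂ ar | inj₂ br = near-r (ar , br)
      closed : NoEdgeOut G (set linked?)
      closed s r s∈ r∉ = ¬-not λ sr → escape (∈-set⁻ linked? s∈) (∉-set⁻ linked? r∉) sr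

  X : Set
  X = Part side false

  Y : Set
  Y = Part side true

  EdgeOfHalfGraph : Rel X 0ℓ → (X → Y) → Fin n → Fin n → Set
  EdgeOfHalfGraph _≤L_ φ u v =
    Σ X λ x → Σ X λ x′ → x ≤L x′ ×
      ((u ≡ proj₁ x × v ≡ proj₁ (φ x′)) ⊎ (v ≡ proj₁ x × u ≡ proj₁ (φ x′)))

  least-neighbour : Prime G → 2K₂-Free → ∀ u → ∃ λ y → u ∼ y ≡ true × (∀ y′ → u ∼ y′ ≡ true → N[ y ]⊆N[ y′ ])
  least-neighbour pG free u with argmin (u ∼_) deg (prime⇒has-neighbour G pG u)
  ... | y , uy , least = y , uy , λ y′ uy′ → 2K₂-free⇒deg-⊆ free (∼∼⇒same-side (∼-flip uy) uy′) (least y′ uy′)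

  module HalfGraphFrom2K₂-Free (pG : Prime G) (free : 2K₂-Free) where

    _≤L_ : Rel X 0ℓ
    x ≤L x′ = N[ proj₁ x′ ]⊆N[ proj₁ x ]

    φ : X → Y
    φ (x , x∈X) = proj₁ (least-neighbour pG free x) , X∼⇒Y x∈X (proj₁ (proj₂ (least-neighbour pG free x)))

    φ₁ : X → Fin n
    φ₁ = proj₁ ∘ φ

    x∼φx : ∀ x → proj₁ x ∼ φ₁ x ≡ true
    x∼φx (x , _) = proj₁ (proj₂ (least-neighbour pG free x))

    ∼φ⇔≤L : ∀ x x′ → (proj₁ x ∼ φ₁ x′ ≡ true → x ≤L x′) × (x ≤L x′ → proj₁ x ∼ φ₁ x′ ≡ true)
    ∼φ⇔≤L (x , _) x′ =
      (λ xφ z x′z → ∼-flip (proj₂ (proj₂ (least-neighbour pG free (proj₁ x′))) z x′z x (∼-flip xφ))) ,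
      (λ x′⊆x → x′⊆x (φ₁ x′) (x∼φx x′))

    ≤L-antisym : ∀ {x y} → x ≤L y → y ≤L x → x ≡ y
    ≤L-antisym y⊆x x⊆y = part-≡ (prime⇒neighbourhood-injective G pG (⊆N-antisym x⊆y y⊆x))

    ≤L-total : ∀ x y → x ≤L y ⊎ y ≤L x
    ≤L-total (x , x∈X) (y , y∈X) with 2K₂-free⇒nested free (trans x∈X (sym y∈X))
    ... | inj₁ x⊆y = inj₂ x⊆y
    ... | inj₂ y⊆x = inj₁ y⊆x

    ≤L-isTotalOrder : IsTotalOrder _≡_ _≤L_
    ≤L-isTotalOrder = record
      { isPartialOrder = record
        { isPreorder = record
          { isEquivalence = isEquivalence
          ; reflexive     = λ { refl z xz → xz }
          ; trans         = λ x≤y y≤z w zw → x≤y w (y≤z w zw)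
          }
        ; antisym = ≤L-antisym
        }
      ; total = ≤L-total
      }

    φ-injective : ∀ {x x′} → φ x ≡ φ x′ → x ≡ x′
    φ-injective {x} {x′} φx≡φx′ =
      ≤L-antisym (proj₁ (∼φ⇔≤L x x′) (subst (λ y → proj₁ x ∼ proj₁ y ≡ true) φx≡φx′ (x∼φx x)))
                 (proj₁ (∼φ⇔≤L x′ x) (subst (λ y → proj₁ x′ ∼ proj₁ y ≡ true) (sym φx≡φx′) (x∼φx x′)))

    -- The least neighbour x₀ of y is mapped back to y: N(y) and N(φ x₀) contain each other.
    φ-surjective : ∀ (y : Y) → ∃ λ x → φ x ≡ y
    φ-surjective (y , y∈Y) with least-neighbour pG free y
    ... | x₀ , yx₀ , x₀-least = x₀X , part-≡ (prime⇒neighbourhood-injective G pG (⊆N-antisym φx₀⊆y y⊆φx₀))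
      where
        x₀X : X
        x₀X = x₀ , Y∼⇒X y∈Y yx₀
        φx₀⊆y : N[ φ₁ x₀X ]⊆N[ y ]
        φx₀⊆y = proj₂ (proj₂ (least-neighbour pG free x₀)) y (∼-flip yx₀)
        y⊆φx₀ : N[ y ]⊆N[ φ₁ x₀X ]
        y⊆φx₀ x yx = ∼-flip (x₀-least x yx (φ₁ x₀X) (x∼φx x₀X))

    edges-match : ∀ u v → (u ∼ v ≡ true → EdgeOfHalfGraph _≤L_ φ u v) × (EdgeOfHalfGraph _≤L_ φ u v → u ∼ v ≡ true)
    edges-match u v = forward , backward
      where
        forward : u ∼ v ≡ true → EdgeOfHalfGraph _≤L_ φ u v
        forward uv with true⊎false (side u)
        ... | inj₂ u∈X with φ-surjective (v , X∼⇒Y u∈X uv)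
        ...   | x′ , refl = (u , u∈X) , x′ , proj₁ (∼φ⇔≤L (u , u∈X) x′) uv , inj₁ (refl , refl)
        forward uv | inj₁ u∈Y with φ-surjective (u , u∈Y) | Y∼⇒X u∈Y uv
        ...   | x′ , refl | v∈X = (v , v∈X) , x′ , proj₁ (∼φ⇔≤L (v , v∈X) x′) (∼-flip uv) , inj₂ (refl , refl)
        backward : EdgeOfHalfGraph _≤L_ φ u v → u ∼ v ≡ true
        backward (x , x′ , x≤x′ , inj₁ (refl , refl)) = proj₂ (∼φ⇔≤L x x′) x≤x′
        backward (x , x′ , x≤x′ , inj₂ (refl , refl)) = ∼-flip (proj₂ (∼φ⇔≤L x x′) x≤x′)

    half-graph : IsHalfGraph G side
    half-graph = _≤L_ , ≤L-isTotalOrder , φ ,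
                 (φ-injective , λ y → proj₁ (φ-surjective y) , λ { refl → proj₂ (φ-surjective y) }) ,
                 edges-match

  module FromHalfGraph (hg : IsHalfGraph G side) where

    _≤L_ : Rel X 0ℓ
    _≤L_ = proj₁ hg

    open IsTotalOrder (proj₁ (proj₂ hg)) using (total; antisym) renaming (refl to ≤L-refl; trans to ≤L-trans)

    φ : X → Y
    φ = proj₁ (proj₂ (proj₂ hg))

    φ₁ : X → Fin n
    φ₁ = proj₁ ∘ φ

    φ-injective : Injective _≡_ _≡_ φ
    φ-injective = proj₁ (proj₁ (proj₂ (proj₂ (proj₂ hg))))

    φ-surjective : Surjective _≡_ _≡_ φ
    φ-surjective = proj₂ (proj₁ (proj₂ (proj₂ (proj₂ hg))))

    edges-match : ∀ u v → (u ∼ v ≡ true → EdgeOfHalfGraph _≤L_ φ u v) × (EdgeOfHalfGraph _≤L_ φ u v → u ∼ v ≡ true)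
    edges-match = proj₂ (proj₂ (proj₂ (proj₂ hg)))

    φ₁∈Y : ∀ x → side (φ₁ x) ≡ true
    φ₁∈Y = proj₂ ∘ φ

    ≤L⇒∼φ : ∀ {x x′} → x ≤L x′ → proj₁ x ∼ φ₁ x′ ≡ true
    ≤L⇒∼φ {x} {x′} x≤x′ = proj₂ (edges-match (proj₁ x) (φ₁ x′)) (x , x′ , x≤x′ , inj₁ (refl , refl))

    ∼φ⇒≤L : ∀ x x′ → proj₁ x ∼ φ₁ x′ ≡ true → x ≤L x′
    ∼φ⇒≤L x x′ xφ with proj₁ (edges-match (proj₁ x) (φ₁ x′)) xφ
    ... | y , y′ , y≤y′ , inj₁ (x≡y , φx′≡φy′) with part-≡ {x = x} {y} x≡y | φ-injective (part-≡ φx′≡φy′)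
    ...   | refl | refl = y≤y′
    ∼φ⇒≤L x x′ xφ | y , y′ , _ , inj₂ (φx′≡y , x≡φy′) =
      ⊥-elim (true≢false (trans (sym (φ₁∈Y x′)) (trans (cong side φx′≡y) (proj₂ y))))

    Y-covered : ∀ u → side u ≡ true → ∃ λ x → u ≡ φ₁ x
    Y-covered u u∈Y with φ-surjective (u , u∈Y)
    ... | x , φx≡u = x , sym (cong proj₁ (φx≡u refl))

    no-crossing : ∀ {p p′ q q′} → p ≤L p′ → q ≤L q′ → ¬ p ≤L q′ → ¬ q ≤L p′ → ⊥
    no-crossing {p} {p′} {q} {q′} p≤p′ q≤q′ p≰q′ q≰p′ with total p q′
    ... | inj₁ p≤q′ = p≰q′ p≤q′
    ... | inj₂ q′≤p = q≰p′ (≤L-trans q≤q′ (≤L-trans q′≤p p≤p′))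

    half⇒2K₂-free : 2K₂-Free
    half⇒2K₂-free a b c d same ab cd ad cb with true⊎false (side a)
    ... | inj₂ a∈X with trans (sym same) a∈X
    ...   | c∈X with Y-covered b (X∼⇒Y a∈X ab) | Y-covered d (X∼⇒Y c∈X cd)
    ...     | xb , refl | xd , refl =
      no-crossing (∼φ⇒≤L (a , a∈X) xb ab) (∼φ⇒≤L (c , c∈X) xd cd)
                  (λ a≤xd → true≢false (trans (sym (≤L⇒∼φ a≤xd)) ad))
                  (λ c≤xb → true≢false (trans (sym (≤L⇒∼φ c≤xb)) cb))
    half⇒2K₂-free a b c d same ab cd ad cb | inj₁ a∈Y with Y-covered a a∈Y | Y-covered c (trans (sym same) a∈Y)
    ...   | xa , refl | xc , refl =
      no-crossing (∼φ⇒≤L (b , Y∼⇒X a∈Y ab) xa (∼-flip ab)) (∼φ⇒≤L (d , Y∼⇒X (trans (sym same) a∈Y) cd) xc (∼-flip cd))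
                  (λ b≤xc → true≢false (trans (sym (≤L⇒∼φ b≤xc)) (∼-flip cb)))
                  (λ d≤xa → true≢false (trans (sym (≤L⇒∼φ d≤xa)) (∼-flip ad)))

    ≤L-≢⇒≁φ : ∀ {x y} → x ≤L y → x ≢ y → proj₁ y ∼ φ₁ x ≡ false
    ≤L-≢⇒≁φ {x} {y} x≤y x≢y = ¬-not λ yφx → x≢y (antisym x≤y (∼φ⇒≤L y x yφx))

    module _ {M : Subset n} (M-module : IsModule G M) where

      private
        ∈M : ∀ {p q z} → M p ≡ true → M q ≡ true → z ∼ p ≡ true → z ∼ q ≡ false → M z ≡ true
        ∈M Mp Mq zp zq = distinguisher∈module G M-module Mp Mq λ zp≡zq → true≢false (trans (sym zp) (trans zp≡zq zq))

        Y≁Y : ∀ x y → φ₁ x ∼ φ₁ y ≡ false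
        Y≁Y x y = same-side⇒≁ (trans (φ₁∈Y x) (sym (φ₁∈Y y)))

        X≁X : ∀ (x y : X) → proj₁ x ∼ proj₁ y ≡ false
        X≁X x y = same-side⇒≁ (trans (proj₂ x) (sym (proj₂ y)))

      -- With an X-vertex x₀ and a Y-vertex φ y₀ in M, first every φ x above x₀, then every X-vertex, then every
      -- Y-vertex is seen to distinguish two members of M.
      module _ (x₀ y₀ : X) (Mx₀ : M (proj₁ x₀) ≡ true) (Mφy₀ : M (φ₁ y₀) ≡ true) where

        φ-above-in : ∀ x → x₀ ≤L x → M (φ₁ x) ≡ true
        φ-above-in x x₀≤x = ∈M Mx₀ Mφy₀ (∼-flip (≤L⇒∼φ x₀≤x)) (Y≁Y x y₀)

        X-in : ∀ x → M (proj₁ x) ≡ true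
        X-in x with total x x₀
        ... | inj₁ x≤x₀ = ∈M (φ-above-in x₀ ≤L-refl) Mx₀ (≤L⇒∼φ x≤x₀) (X≁X x x₀)
        ... | inj₂ x₀≤x = ∈M (φ-above-in x x₀≤x) Mx₀ (≤L⇒∼φ ≤L-refl) (X≁X x x₀)

        mixed-module-full : ∀ u → M u ≡ true
        mixed-module-full u with true⊎false (side u)
        ... | inj₂ u∈X = X-in (u , u∈X)
        ... | inj₁ u∈Y with Y-covered u u∈Y
        ...   | x , refl = ∈M (X-in x) Mφy₀ (∼-flip (≤L⇒∼φ ≤L-refl)) (Y≁Y x y₀)

      two-in-module-full : ∀ {a b} → M a ≡ true → M b ≡ true → a ≢ b → ∀ u → M u ≡ true
      two-in-module-full {a} {b} Ma Mb a≢b with true⊎false (side a) | true⊎false (side b)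
      ... | inj₂ a∈X | inj₁ b∈Y with Y-covered b b∈Y
      ...   | y , refl = mixed-module-full (a , a∈X) y Ma Mb
      two-in-module-full {a} {b} Ma Mb a≢b | inj₁ a∈Y | inj₂ b∈X with Y-covered a a∈Y
      ...   | y , refl = mixed-module-full (b , b∈X) y Mb Ma
      two-in-module-full {a} {b} Ma Mb a≢b | inj₂ a∈X | inj₂ b∈X with total (a , a∈X) (b , b∈X)
      ... | inj₁ a≤b = mixed-module-full (a , a∈X) (a , a∈X) Ma
                         (∈M Ma Mb (∼-flip (≤L⇒∼φ ≤L-refl)) (∼-flip (≤L-≢⇒≁φ a≤b (a≢b ∘ cong proj₁))))
      ... | inj₂ b≤a = mixed-module-full (b , b∈X) (b , b∈X) Mb
                         (∈M Mb Ma (∼-flip (≤L⇒∼φ ≤L-refl)) (∼-flip (≤L-≢⇒≁φ b≤a (a≢b ∘ sym ∘ cong proj₁))))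
      two-in-module-full {a} {b} Ma Mb a≢b | inj₁ a∈Y | inj₁ b∈Y with Y-covered a a∈Y | Y-covered b b∈Y
      ... | x , refl | y , refl with total x y
      ...   | inj₁ x≤y = mixed-module-full y y (∈M Mb Ma (≤L⇒∼φ ≤L-refl) (≤L-≢⇒≁φ x≤y (a≢b ∘ cong φ₁))) Mb
      ...   | inj₂ y≤x = mixed-module-full x x (∈M Ma Mb (≤L⇒∼φ ≤L-refl) (≤L-≢⇒≁φ y≤x (a≢b ∘ sym ∘ cong φ₁))) Ma

    half⇒prime : 3 ≤ n → Prime G
    half⇒prime 3≤n = 3≤n , trivial
      where
        trivial : ∀ M → IsModule G M → IsTrivialModule M
        trivial M M-module with trivial⊎nontrivial M
        ... | inj₁ M-trivial = M-trivial
        ... | inj₂ (a , b , c , Ma , Mb , a≢b , Mc) =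
          ⊥-elim (true≢false (trans (sym (two-in-module-full M-module Ma Mb a≢b c)) Mc))

  -- The witness of v is its neighbour y of least degree, paired with a candidate y′ of largest degree
  -- (or with ∅ if v is the only neighbour of y).
  module WitnessFrom2K₂-Free (pG : Prime G) (free : 2K₂-Free) (v : Fin n) where

    y : Fin n
    y = proj₁ (least-neighbour pG free v)

    vy : v ∼ y ≡ true
    vy = proj₁ (proj₂ (least-neighbour pG free v))

    y-least : ∀ w → v ∼ w ≡ true → N[ y ]⊆N[ w ]
    y-least = proj₂ (proj₂ (least-neighbour pG free v))

    Candidate : Fin n → Set
    Candidate w = side w ≡ side y × v ∼ w ≡ false × N[ w ]⊆N[ y ]

    candidate? : ∀ w → Dec (Candidate w)
    candidate? w = (side w Bool.≟ side y) ×-dec (v ∼ w Bool.≟ false) ×-dec ⊆N? w y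

    candidate-exists : ∀ {z} → z ≢ v → y ∼ z ≡ true → ∃ λ w → set candidate? w ≡ true
    candidate-exists {z} z≢v yz with prime⇒distinguishing G pG (z≢v ∘ sym)
    ... | u , uv≢uz with true⊎false (u ∼ z)
    ...   | inj₂ uz = ⊥-elim (true≢false (trans (sym (y-least u (∼-flip uv) z yz)) uz))
      where
        uv : u ∼ v ≡ true
        uv = ¬-not (uv≢uz ∘ flip trans (sym uz))
    ...   | inj₁ uz = u , ∈-set⁺ candidate? (u~y , vu , u⊆y)
      where
        vu : v ∼ u ≡ false
        vu = ∼-flip (¬-not (uv≢uz ∘ flip trans (sym uz)))
        u~y : side u ≡ side y
        u~y = ∼∼⇒same-side uz (∼-flip yz)
        u⊆y : N[ u ]⊆N[ y ]
        u⊆y with 2K₂-free⇒nested free u~y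
        ... | inj₁ u⊆y = u⊆y
        ... | inj₂ y⊆u = ⊥-elim (true≢false (trans (sym (y⊆u v (∼-flip vy))) (∼-flip vu)))

    module _ (y′ : Fin n) (y′-candidate : Candidate y′) (y′-max : ∀ w → Candidate w → deg w ≤ deg y′) where

      v-i-twins : ∀ {i} → y ∼ i ≡ true → y′ ∼ i ≡ false → ∀ w → w ≢ v → w ≢ i → w ∼ v ≡ w ∼ i
      v-i-twins {i} yi y′i w _ _ with side w Bool.≟ side v
      ... | yes w~v = trans (same-side⇒≁ w~v) (sym (same-side⇒≁ (trans w~v (∼∼⇒same-side vy yi))))
      ... | no w≁v with ≢-≢⇒≡ w≁v (∼⇒other-side vy)
      ...   | w~y with 2K₂-free⇒nested free w~y
      ...     | inj₂ y⊆w = trans (y⊆w v (∼-flip vy)) (sym (y⊆w i yi))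
      ...     | inj₁ w⊆y with true⊎false (w ∼ v)
      ...       | inj₁ wv = trans wv (sym (y-least w (∼-flip wv) i yi))
      ...       | inj₂ wv = trans wv (sym (¬-not y′-beats-w))
        where
          w-candidate : Candidate w
          w-candidate = w~y , ∼-flip wv , w⊆y
          y′-beats-w : w ∼ i ≢ true
          y′-beats-w wi with 2K₂-free⇒nested free (trans (proj₁ w-candidate) (sym (proj₁ y′-candidate)))
          ... | inj₁ w⊆y′ = true≢false (trans (sym (w⊆y′ i wi)) y′i)
          ... | inj₂ y′⊆w = ℕ.<⇒≱ (deg-mono-< y′⊆w wi y′i) (y′-max w w-candidate)

      y-y′-twins-but-v : DiffersOnlyAt (y ∼_) (y′ ∼_) v
      y-y′-twins-but-v = yv≢y′v , agree
        where
          yv≢y′v : y ∼ v ≢ y′ ∼ v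
          yv≢y′v yv≡y′v = true≢false (trans (sym (∼-flip vy)) (trans yv≡y′v (∼-flip (proj₁ (proj₂ y′-candidate)))))
          agree : ∀ i → i ≢ v → y ∼ i ≡ y′ ∼ i
          agree i i≢v with true⊎false (y′ ∼ i) | true⊎false (y ∼ i)
          ... | inj₁ y′i | _       = trans (proj₂ (proj₂ y′-candidate) i y′i) (sym y′i)
          ... | inj₂ y′i | inj₂ yi = trans yi (sym y′i)
          ... | inj₂ y′i | inj₁ yi = ⊥-elim (prime⇒no-twins G pG (i≢v ∘ sym) (v-i-twins yi y′i))

    witness : Witness v
    witness with any? (λ z → (y ∼ z Bool.≟ true) ×-dec ¬? (z ≟ v))
    ... | no only-v = y , nothing , (λ yv≡false → true≢false (trans (sym (∼-flip vy)) yv≡false)) ,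
                      λ i i≢v → ¬-not λ yi → only-v (i , yi , i≢v)
    ... | yes (z , yz , z≢v) with argmax (set candidate?) deg (candidate-exists z≢v yz)
    ...   | y′ , y′∈ , y′-max =
      y , just y′ , y-y′-twins-but-v y′ (∈-set⁻ candidate? y′∈) (λ w c → y′-max w (∈-set⁺ candidate? c))

  prime∧2K₂-free⇒witness : Prime G → 2K₂-Free → ∀ v → Witness v
  prime∧2K₂-free⇒witness = WitnessFrom2K₂-Free.witness

  side? : ∀ γ z → Dec (side z ≡ γ)
  side? γ z = side z Bool.≟ γ

  Side : Bool → Subset n
  Side γ = set (side? γ)

  opposite : ∀ {γ w z} → side w ≡ γ → w ∼ z ≡ true → Side (not γ) z ≡ true
  opposite {γ} w∈γ wz = ∈-set⁺ (side? (not γ)) (trans (¬-not (∼⇒other-side wz ∘ sym)) (cong not w∈γ))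

  Within : Subset n → Maybe (Fin n) → Set
  Within A nothing  = ⊤
  Within A (just b) = A b ≡ true

  WitnessWithin : Subset n → Fin n → Set
  WitnessWithin A l = ∃ λ a → ∃ λ b → DiffersOnlyAt (a ∼_) (nbhd b) l × A a ≡ true × Within A b

  data SeparatedOutside (L : Subset n) (b b′ : Maybe (Fin n)) : Set where
    separated-at : ∀ c → L c ≡ false → nbhd b c ≢ nbhd b′ c → SeparatedOutside L b b′

  rows : Subset n → List (Vec Bool n)
  rows A = tabulate ∅ ∷ map (tabulate ∘ _∼_) (members A)

  private
    row∈rows : ∀ {A} b → Within A b → tabulate (nbhd b) ∈ rows A
    row∈rows nothing  _  = here refl
    row∈rows (just b) Ab = there (∈-map⁺ (tabulate ∘ _∼_) (∈-members⁺ Ab))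

    tabulate-DiffersOnlyAt : ∀ {f g : Subset n} {l} → DiffersOnlyAt f g l →
                             DiffersOnlyAt (lookup (tabulate f)) (lookup (tabulate g)) l
    tabulate-DiffersOnlyAt {f} {g} {l} (fl≢gl , f≗g) =
      (λ e → fl≢gl (trans (sym (lookup∘tabulate f l)) (trans e (lookup∘tabulate g l)))) ,
      λ i i≢l → trans (lookup∘tabulate f i) (trans (f≗g i i≢l) (sym (lookup∘tabulate g i)))

    clearAll-separates : ∀ {L b b′} → SeparatedOutside L b b′ →
                         clearAll (members L) (tabulate (nbhd b)) ≢ clearAll (members L) (tabulate (nbhd b′))
    clearAll-separates {L} {b} {b′} (separated-at c Lc bc≢b′c) e =
      bc≢b′c (trans (sym (lookup∘tabulate (nbhd b) c))
             (trans (sym (lookup-clearAll (members L) _ c∉))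
             (trans (cong (λ w → lookup w c) e)
             (trans (lookup-clearAll (members L) _ c∉) (lookup∘tabulate (nbhd b′) c)))))
      where
        c∉ : ¬ c ∈ members L
        c∉ c∈ = true≢false (trans (sym (∈-members⁻ c∈)) Lc)

  -- The zero row and the rows of A number 1 + |A|; each witnessed coordinate of L costs one distinct row
  -- (distinct-clearAll), and rows still separated outside L remain distinct.
  witness-count : (A L : Subset n) → (∀ l → L l ≡ true → WitnessWithin A l) →
                  (bs : List (Maybe (Fin n))) → All (Within A) bs → AllPairs (SeparatedOutside L) bs →
                  size L + length bs ≤ suc (size A)
  witness-count A L witnessed bs bs⊆A bs-separated =
    ℕ.≤-trans (ℕ.≤-reflexive (cong (size L +_) (sym (length-map row bs))))
   (ℕ.≤-trans (coordinate-bound (members L) (members-unique L) (rows A) pairs (map row bs)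
                                (separated bs-separated) (in-rows bs⊆A))
              (ℕ.≤-reflexive (cong suc (length-map (tabulate ∘ _∼_) (members A)))))
    where
      row : Maybe (Fin n) → Vec Bool n
      row b = clearAll (members L) (tabulate (nbhd b))
      pairs : All (HasPairDifferingOnlyAt (rows A)) (members L)
      pairs = All.tabulate λ {l} l∈ → pair (witnessed l (∈-members⁻ l∈))
        where
          pair : ∀ {l} → WitnessWithin A l → HasPairDifferingOnlyAt (rows A) l
          pair (a , b , d , Aa , Ab) =
            _ , _ , row∈rows (just a) Aa , row∈rows b Ab , tabulate-DiffersOnlyAt d
      separated : ∀ {bs} → AllPairs (SeparatedOutside L) bs → AllPairs _≢_ (map row bs)
      separated [] = []
      separated {b ∷ _} (b≁bs ∷ bs-separated) =
        AllP.map⁺ (All.map (λ {b′} → clearAll-separates {L} {b} {b′}) b≁bs) ∷ separated bs-separated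
      in-rows : ∀ {bs} → All (Within A) bs → All (_∈ map (clearAll (members L)) (rows A)) (map row bs)
      in-rows []          = []
      in-rows (Ab ∷ bs⊆A) = ∈-map⁺ (clearAll (members L)) (row∈rows _ Ab) ∷ in-rows bs⊆A

  -- The zero row and the row of q are separated outside L, at c.
  witnessed-smaller : ∀ {L Q q c} → (∀ l → L l ≡ true → WitnessWithin Q l) → Q q ≡ true → L c ≡ false →
                      q ∼ c ≡ true → size L < size Q
  witnessed-smaller {L} {Q} {q} {c} witnessed Qq Lc qc =
    ℕ.≤-pred (ℕ.≤-trans (ℕ.≤-reflexive (ℕ.+-comm 2 (size L)))
      (witness-count Q L witnessed (nothing ∷ just q ∷ []) (tt ∷ Qq ∷ [])
                     ((separated-at c Lc (λ e → true≢false (trans (sym qc) (sym e))) ∷ []) ∷ [] ∷ [])))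

  witness-other-side : Prime G → ∀ {a b l} → DiffersOnlyAt (a ∼_) (nbhd b) l → side a ≢ side l
  witness-other-side pG {a} {b} {l} (al≢bl , agree) with true⊎false (a ∼ l)
  ... | inj₁ al = ∼⇒other-side al
  ... | inj₂ al with b | ¬-not (al≢bl ∘ trans al ∘ sym)
  ...   | nothing | ()
  ...   | just b | bl with prime⇒has-neighbour G pG a
  ...     | t , at = λ a~l → ∼⇒other-side bl (trans (sym a~b) a~l)
    where
      a~b : side a ≡ side b
      a~b = ∼∼⇒same-side at (∼-flip (trans (sym (agree t λ { refl → true≢false (trans (sym at) al) })) at))

  module AllWitnessed (pG : Prime G) (witnessed : ∀ v → Witness v) where

    witness-within-other-side : ∀ γ l → Side γ l ≡ true → WitnessWithin (Side (not γ)) l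
    witness-within-other-side γ l l∈γ with witnessed l
    ... | a , b , d = a , b , d , other (witness-other-side pG {b = b} d) , within b d
      where
        other : ∀ {z} → side z ≢ side l → Side (not γ) z ≡ true
        other z≁l = ∈-set⁺ (side? (not γ)) (trans (¬-not z≁l) (cong not (∈-set⁻ (side? γ) l∈γ)))
        within : ∀ b → DiffersOnlyAt (a ∼_) (nbhd b) l → Within (Side (not γ)) b
        within nothing  _ = tt
        within (just b) d = other (witness-other-side pG {b = just a} (DiffersOnlyAt-sym d))

    sides-balanced : ∀ γ → size (Side γ) ≤ size (Side (not γ))
    sides-balanced γ = ℕ.≤-pred (ℕ.≤-trans (ℕ.≤-reflexive (ℕ.+-comm 1 (size (Side γ))))
      (witness-count (Side (not γ)) (Side γ) (witness-within-other-side γ) (nothing ∷ []) (tt ∷ []) ([] ∷ [])))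

    -- Two vertices on one side with a common neighbour cannot both have private neighbours: the four rows
    -- 0, N(s), N(s′), N(t) stay distinct off u and u′, so the other side would outnumber this one.
    no-crossing-private-neighbours : ∀ {u u′ t s s′} → side u ≡ side u′ → u ∼ t ≡ true → u′ ∼ t ≡ true →
                                     u ∼ s ≡ true → u′ ∼ s ≡ false → u′ ∼ s′ ≡ true → u ∼ s′ ≡ false → ⊥
    no-crossing-private-neighbours {u} {u′} {t} {s} {s′} u~u′ ut u′t us u′s u′s′ us′ =
      ℕ.<⇒≱ too-many (witness-count (Side (not γ)) L L-witnessed bs bs⊆ bs-separated)
      where
        γ : Bool
        γ = side u
        rest? : ∀ z → Dec (side z ≡ γ × z ≢ u × z ≢ u′)
        rest? z = side? γ z ×-dec ¬? (z ≟ u) ×-dec ¬? (z ≟ u′)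
        L : Subset n
        L = set rest?
        Lu : L u ≡ false
        Lu = ∉-set⁺ rest? λ (_ , u≢u , _) → u≢u refl
        Lu′ : L u′ ≡ false
        Lu′ = ∉-set⁺ rest? λ (_ , _ , u′≢u′) → u′≢u′ refl
        L-witnessed : ∀ l → L l ≡ true → WitnessWithin (Side (not γ)) l
        L-witnessed l l∈ = witness-within-other-side γ l (∈-set⁺ (side? γ) (proj₁ (∈-set⁻ rest? l∈)))
        bs : List (Maybe (Fin n))
        bs = nothing ∷ just s ∷ just s′ ∷ just t ∷ []
        bs⊆ : All (Within (Side (not γ))) bs
        bs⊆ = tt ∷ opposite refl us ∷ opposite (sym u~u′) u′s′ ∷ opposite refl ut ∷ []
        sep : ∀ {b b′ c} → L c ≡ false → nbhd b c ≡ false → nbhd b′ c ≡ true → SeparatedOutside L b b′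
        sep {c = c} Lc bc b′c = separated-at c Lc λ e → true≢false (trans (sym b′c) (trans (sym e) bc))
        bs-separated : AllPairs (SeparatedOutside L) bs
        bs-separated =
          (sep Lu refl (∼-flip us) ∷ sep Lu′ refl (∼-flip u′s′) ∷ sep Lu refl (∼-flip ut) ∷ []) ∷
          (sep-sym (sep Lu (∼-flip us′) (∼-flip us)) ∷ sep Lu′ (∼-flip u′s) (∼-flip u′t) ∷ []) ∷
          (sep Lu (∼-flip us′) (∼-flip ut) ∷ []) ∷ [] ∷ []
          where
            sep-sym : ∀ {b b′} → SeparatedOutside L b b′ → SeparatedOutside L b′ b
            sep-sym (separated-at c Lc ne) = separated-at c Lc (ne ∘ sym)
        too-many : suc (size (Side (not γ))) < size L + length bs
        too-many = begin-strict
          suc (size (Side (not γ)))   ≤⟨ s≤s (sides-balanced (not γ)) ⟩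
          suc (size (Side (not (not γ)))) ≡⟨ cong (λ g → suc (size (Side g))) (Bool.not-involutive γ) ⟩
          suc (size (Side γ))         ≤⟨ s≤s (size-mono-except₂ u u′ λ z z∈ z≢u z≢u′ →
                                                 ∈-set⁺ rest? (∈-set⁻ (side? γ) z∈ , z≢u , z≢u′)) ⟩
          3 + size L                  <⟨ ℕ.n<1+n _ ⟩
          4 + size L                  ≡⟨ ℕ.+-comm 4 (size L) ⟩
          size L + length bs          ∎
          where open ℕ.≤-Reasoning

    -- For x of maximal degree on its side, the vertices adjacent to x or with neighbourhood inside N(x) form a
    -- set without outgoing edges, hence contain everything.
    module _ (x : Fin n) (x-maximal : ∀ z → side z ≡ side x → deg z ≤ deg x) where

      private
        dominated? : ∀ z → Dec (x ∼ z ≡ true ⊎ side z ≡ side x × N[ z ]⊆N[ x ])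
        dominated? z = (x ∼ z Bool.≟ true) ⊎-dec (side? (side x) z ×-dec ⊆N? z x)

        escape : ∀ {s r} → set dominated? s ≡ true → set dominated? r ≡ false → s ∼ r ≡ true → ⊥
        escape {s} {r} s∈ r∉ sr with ∈-set⁻ dominated? s∈ | ∉-set⁻ dominated? r∉
        ... | inj₂ (_ , s⊆x) | undominated = undominated (inj₁ (s⊆x r sr))
        ... | inj₁ xs        | undominated with ∼∼⇒same-side (∼-flip sr) (∼-flip xs) | ⊆N? r x
        ...   | r~x | yes r⊆x = undominated (inj₂ (r~x , r⊆x))
        ...   | r~x | no r⊈x with ⊈N⇒private-neighbour r⊈x | ⊆N? x r
        ...     | s₁ , rs₁ , xs₁ | yes x⊆r = ℕ.<⇒≱ (deg-mono-< x⊆r rs₁ xs₁) (x-maximal r r~x)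
        ...     | s₁ , rs₁ , xs₁ | no x⊈r with ⊈N⇒private-neighbour x⊈r
        ...       | s₂ , xs₂ , rs₂ = no-crossing-private-neighbours r~x (∼-flip sr) xs rs₁ xs₁ xs₂ rs₂

      max-degree-universal : ∀ {z} → side z ≢ side x → z ∼ x ≡ true
      max-degree-universal {z} z≁x = ¬-not λ zx →
        prime⇒connected G pG {set dominated?} (λ s r s∈ r∉ → ¬-not (escape s∈ r∉)) {x} {z}
          (∈-set⁺ dominated? (inj₂ (refl , λ _ xw → xw)))
          (∉-set⁺ dominated? λ { (inj₁ xz) → true≢false (trans (sym xz) (∼-flip zx)) ; (inj₂ (z~x , _)) → z≁x z~x })

    all-witnessed⇒2K₂-free : 2K₂-Free
    all-witnessed⇒2K₂-free a b c d same ab cd ad cb with argmax (Side (side b)) deg (b , ∈-set⁺ (side? (side b)) refl)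
    ... | x , x∈ , x-max =
      no-crossing-private-neighbours same (x-universal (∼⇒other-side ab)) (x-universal (∼⇒other-side ab ∘ trans same))
                                     ab cb cd ad
      where
        x~b : side x ≡ side b
        x~b = ∈-set⁻ (side? (side b)) x∈
        x-universal : ∀ {z} → side z ≢ side b → z ∼ x ≡ true
        x-universal z≁b = max-degree-universal x (λ z z~x → x-max z (∈-set⁺ (side? (side b)) (trans z~x x~b)))
                                             (z≁b ∘ flip trans x~b)

  module InCutSide (pG : Prime G) {w : Fin n} {S : Subset n} (cut : CutSide w S) where

    Sw : S w ≡ false
    Sw = proj₁ cut

    no-edge-out : NoEdgeOutExcept w S
    no-edge-out = proj₂ (proj₂ (proj₂ cut))

    neighbour-in-S-or-w : ∀ {x i} → S x ≡ true → x ∼ i ≡ true → S i ≡ true ⊎ i ≡ w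
    neighbour-in-S-or-w {x} {i} Sx xi with true⊎false (S i) | i ≟ w
    ... | inj₁ Si | _        = inj₁ Si
    ... | inj₂ _  | yes i≡w = inj₂ i≡w
    ... | inj₂ Si | no i≢w  = ⊥-elim (true≢false (trans (sym xi) (no-edge-out x i Sx Si i≢w)))

    w-neighbour-in-S : ∃ λ u₀ → S u₀ ≡ true × w ∼ u₀ ≡ true
    w-neighbour-in-S with any? (λ z → (S z Bool.≟ true) ×-dec (w ∼ z Bool.≟ true))
    ... | yes found = found
    ... | no none = ⊥-elim (prime⇒connected G pG {S} closed (proj₂ (proj₁ (proj₂ cut))) Sw)
      where
        closed : NoEdgeOut G S
        closed s r Ss Sr with r ≟ w
        ... | no r≢w   = no-edge-out s r Ss Sr r≢w
        ... | yes refl = ∼-flip (¬-not λ ws → none (s , Ss , ws))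

    w-neighbour-outside-S : ∃ λ r → S r ≡ false × r ≢ w × w ∼ r ≡ true
    w-neighbour-outside-S with any? (λ z → (S z Bool.≟ false) ×-dec ¬? (z ≟ w) ×-dec (w ∼ z Bool.≟ true))
    ... | yes found = found
    ... | no none with proj₁ (proj₂ (proj₂ cut))
    ...   | r₀ , r₀≢w , Sr₀ =
      ⊥-elim (prime⇒connected G pG {set outside?} closed
                (∈-set⁺ outside? (Sr₀ , r₀≢w)) (∉-set⁺ outside? λ (_ , w≢w) → w≢w refl))
      where
        outside? : ∀ z → Dec (S z ≡ false × z ≢ w)
        outside? z = (S z Bool.≟ false) ×-dec ¬? (z ≟ w)
        closed : NoEdgeOut G (set outside?)
        closed s r s∈ r∉ with ∈-set⁻ outside? s∈ | ∉-set⁻ outside? r∉ | true⊎false (S r) | r ≟ w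
        ... | Ss , s≢w | _        | inj₁ Sr | _        = ∼-flip (no-edge-out r s Sr Ss s≢w)
        ... | Ss , s≢w | _        | inj₂ _  | yes refl = ∼-flip (¬-not λ ws → none (s , Ss , s≢w , ws))
        ... | _        | r-inside | inj₂ Sr | no r≢w  = ⊥-elim (r-inside (Sr , r≢w))

    module _ (no-pendant : ¬ Pendant w) where

      u₀ : Fin n
      u₀ = proj₁ w-neighbour-in-S

      Su₀ : S u₀ ≡ true
      Su₀ = proj₁ (proj₂ w-neighbour-in-S)

      wu₀ : w ∼ u₀ ≡ true
      wu₀ = proj₂ (proj₂ w-neighbour-in-S)

      only-neighbour-w-impossible : ∀ a → (∀ i → a ∼ i ≡ true → i ≡ w) → ⊥
      only-neighbour-w-impossible a only-w with prime⇒has-neighbour G pG a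
      ... | t , at with only-w t at
      ...   | refl = no-pendant (a , (λ aw → true≢false (trans (sym at) aw)) ,
                                λ i i≢w → ¬-not λ ai → i≢w (only-w i ai))

      u₀-neighbour-in-S : ∃ λ x → S x ≡ true × u₀ ∼ x ≡ true
      u₀-neighbour-in-S with any? (λ z → (S z Bool.≟ true) ×-dec (u₀ ∼ z Bool.≟ true))
      ... | yes found = found
      ... | no none = ⊥-elim (only-neighbour-w-impossible u₀ only-w)
        where
          only-w : ∀ i → u₀ ∼ i ≡ true → i ≡ w
          only-w i u₀i with neighbour-in-S-or-w Su₀ u₀i
          ... | inj₁ Si  = ⊥-elim (none (i , Si , u₀i))
          ... | inj₂ i≡w = i≡w

      -- The partner of w would be adjacent to u₀, hence in S, and to the neighbour of w outside S.
      ¬w-witness : ∀ {u b} → S u ≡ true → u ≢ u₀ → ¬ DiffersOnlyAt (w ∼_) (nbhd b) u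
      ¬w-witness {u} {nothing} Su u≢u₀ (_ , agree) = true≢false (trans (sym wu₀) (agree u₀ (u≢u₀ ∘ sym)))
      ¬w-witness {u} {just b} Su u≢u₀ (wu≢bu , agree)
        with neighbour-in-S-or-w Su₀ (∼-flip (trans (sym (agree u₀ (u≢u₀ ∘ sym))) wu₀))
      ... | inj₂ refl = wu≢bu refl
      ... | inj₁ Sb with w-neighbour-outside-S
      ...   | r , Sr , r≢w , wr =
        true≢false (trans (sym (trans (sym (agree r λ { refl → true≢false (trans (sym Su) Sr) })) wr))
                          (no-edge-out b r Sb Sr r≢w))

      adjacent-witness-in-S : ∀ {u a b} → S u ≡ true → u ≢ u₀ → DiffersOnlyAt (a ∼_) (nbhd b) u →
                              a ∼ u ≡ true → S a ≡ true
      adjacent-witness-in-S {b = b} Su u≢u₀ d au with neighbour-in-S-or-w Su (∼-flip au)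
      ... | inj₁ Sa   = Sa
      ... | inj₂ refl = ⊥-elim (¬w-witness {b = b} Su u≢u₀ d)

      -- The partner of a is adjacent to u, hence in S; so a is in S, is w, or is pendant at w.
      nonadjacent-witness-in-S : ∀ {u a b} → S u ≡ true → u ≢ u₀ → DiffersOnlyAt (a ∼_) (nbhd b) u →
                                 a ∼ u ≡ false → S a ≡ true
      nonadjacent-witness-in-S {b = nothing} Su u≢u₀ (au≢ , _) au = ⊥-elim (au≢ au)
      nonadjacent-witness-in-S {u} {a} {just b} Su u≢u₀ d au
        with any? (λ t → (S t Bool.≟ true) ×-dec (a ∼ t Bool.≟ true))
      ... | yes (t , St , at) with neighbour-in-S-or-w St (∼-flip at)
      ...   | inj₁ Sa   = Sa
      ...   | inj₂ refl = ⊥-elim (¬w-witness {b = just b} Su u≢u₀ d)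
      nonadjacent-witness-in-S {u} {a} {just b} Su u≢u₀ d au | no none =
        ⊥-elim (only-neighbour-w-impossible a only-w)
        where
          Sb : S b ≡ true
          Sb = adjacent-witness-in-S {b = just a} Su u≢u₀ (DiffersOnlyAt-sym d) (¬-not (proj₁ d ∘ trans au ∘ sym))
          only-w : ∀ i → a ∼ i ≡ true → i ≡ w
          only-w i ai
            with neighbour-in-S-or-w Sb (trans (sym (proj₂ d i λ { refl → true≢false (trans (sym ai) au) })) ai)
          ... | inj₁ Si  = ⊥-elim (none (i , Si , ai))
          ... | inj₂ i≡w = i≡w

      witness-in-S : ∀ {u a b} → S u ≡ true → u ≢ u₀ → DiffersOnlyAt (a ∼_) (nbhd b) u → S a ≡ true
      witness-in-S {u} {a} {b} Su u≢u₀ d with true⊎false (a ∼ u)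
      ... | inj₁ au = adjacent-witness-in-S {b = b} Su u≢u₀ d au
      ... | inj₂ au = nonadjacent-witness-in-S {b = b} Su u≢u₀ d au

      in-S∩? : ∀ γ z → Dec (S z ≡ true × side z ≡ γ)
      in-S∩? γ z = (S z Bool.≟ true) ×-dec side? γ z

      S∩ : Bool → Subset n
      S∩ γ = set (in-S∩? γ)

      witnessed-within : (∀ u → S u ≡ true → Witness u) →
                         ∀ γ l → S l ≡ true → side l ≢ γ → l ≢ u₀ → WitnessWithin (S∩ γ) l
      witnessed-within S-witnessed γ l Sl l≁γ l≢u₀ with S-witnessed l Sl
      ... | a , b , d = a , b , d , inside b d , within b d
        where
          inside : ∀ {z} b → DiffersOnlyAt (z ∼_) (nbhd b) l → S∩ γ z ≡ true
          inside b d = ∈-set⁺ (in-S∩? γ) (witness-in-S {b = b} Sl l≢u₀ d , ≢-≢⇒≡ (witness-other-side pG {b = b} d) l≁γ)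
          within : ∀ b → DiffersOnlyAt (a ∼_) (nbhd b) l → Within (S∩ γ) b
          within nothing  _ = tt
          within (just b) d = inside (just a) (DiffersOnlyAt-sym d)

      -- With β the side of w, counting witnesses gives |S ∩ β| < |S ∩ ¬β| (the rows 0 and N(u₀) differ at w)
      -- and |S ∩ ¬β - u₀| < |S ∩ β| (the rows 0 and N(x) differ at u₀, for x a neighbour of u₀ in S).
      witnessed-cut-side-impossible : (∀ u → S u ≡ true → Witness u) → ⊥
      witnessed-cut-side-impossible S-witnessed = ℕ.<-irrefl refl (begin-strict
        size (S∩ β)                 <⟨ witnessed-smaller β-witnessed u₀∈S∩¬β w∉S∩β (∼-flip wu₀) ⟩
        size (S∩ (not β))           ≤⟨ size-mono-except u₀ (λ z z∈ z≢u₀ → ∈-set⁺ minus-u₀? (z∈ , z≢u₀)) ⟩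
        suc (size (set minus-u₀?))  ≤⟨ witnessed-smaller ¬β-witnessed x∈S∩β u₀∉S∩¬β-u₀ (∼-flip u₀x) ⟩
        size (S∩ β)                 ∎)
        where
          open ℕ.≤-Reasoning
          β : Bool
          β = side w
          u₀∈¬β : side u₀ ≡ not β
          u₀∈¬β = ¬-not (∼⇒other-side (∼-flip wu₀))
          x : Fin n
          x = proj₁ u₀-neighbour-in-S
          Sx : S x ≡ true
          Sx = proj₁ (proj₂ u₀-neighbour-in-S)
          u₀x : u₀ ∼ x ≡ true
          u₀x = proj₂ (proj₂ u₀-neighbour-in-S)
          x∈β : side x ≡ β
          x∈β = sym (∼∼⇒same-side wu₀ u₀x)
          minus-u₀? : ∀ z → Dec (S∩ (not β) z ≡ true × z ≢ u₀)
          minus-u₀? z = (S∩ (not β) z Bool.≟ true) ×-dec ¬? (z ≟ u₀)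
          u₀∈S∩¬β : S∩ (not β) u₀ ≡ true
          u₀∈S∩¬β = ∈-set⁺ (in-S∩? (not β)) (Su₀ , u₀∈¬β)
          w∉S∩β : S∩ β w ≡ false
          w∉S∩β = ∉-set⁺ (in-S∩? β) λ (Sw′ , _) → true≢false (trans (sym Sw′) Sw)
          x∈S∩β : S∩ β x ≡ true
          x∈S∩β = ∈-set⁺ (in-S∩? β) (Sx , x∈β)
          u₀∉S∩¬β-u₀ : set minus-u₀? u₀ ≡ false
          u₀∉S∩¬β-u₀ = ∉-set⁺ minus-u₀? λ (_ , u₀≢u₀) → u₀≢u₀ refl
          β-witnessed : ∀ l → S∩ β l ≡ true → WitnessWithin (S∩ (not β)) l
          β-witnessed l l∈ with ∈-set⁻ (in-S∩? β) l∈
          ... | Sl , l∈β = witnessed-within S-witnessed (not β) l Sl (Bool.not-¬ l∈β)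
                                            λ { refl → ∼⇒other-side (∼-flip wu₀) l∈β }
          ¬β-witnessed : ∀ l → set minus-u₀? l ≡ true → WitnessWithin (S∩ β) l
          ¬β-witnessed l l∈ with ∈-set⁻ minus-u₀? l∈
          ... | l∈¬β , l≢u₀ with ∈-set⁻ (in-S∩? (not β)) l∈¬β
          ...   | Sl , l~¬β =
            witnessed-within S-witnessed β l Sl (λ l~β → Bool.not-¬ refl (trans (sym l~β) l~¬β)) l≢u₀


module Deletion {m : ℕ} (G : Graph (suc m)) (side : Fin (suc m) → Bool) (bip : IsBipartition G side) where
  open Bipartite G side bip

  ≢⇒punchIn : ∀ {v u : Fin (suc m)} → u ≢ v → ∃ λ u′ → u ≡ punchIn v u′
  ≢⇒punchIn {v} {u} u≢v = punchOut (u≢v ∘ sym) , sym (punchIn-punchOut (u≢v ∘ sym))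

  lift : Fin (suc m) → Subset m → Subset (suc m)
  lift v M u with v ≟ u
  ... | yes _   = false
  ... | no v≢u = M (punchOut v≢u)

  lift-v : ∀ v M → lift v M v ≡ false
  lift-v v M with v ≟ v
  ... | yes _   = refl
  ... | no v≢v = ⊥-elim (v≢v refl)

  lift-punchIn : ∀ v M i → lift v M (punchIn v i) ≡ M i
  lift-punchIn v M i with v ≟ punchIn v i
  ... | yes v≡i  = ⊥-elim (punchInᵢ≢i v i (sym v≡i))
  ... | no v≢i = cong M (trans (punchOut-cong v refl) (punchOut-punchIn v))

  witness⇒¬prime-deletion : ∀ v → Witness v → ¬ Prime (G ─ v)
  witness⇒¬prime-deletion v (a , nothing , d) pGv with ≢⇒punchIn (witness-≢ {b = nothing} d)
  ... | a′ , refl with prime⇒has-neighbour (G ─ v) pGv a′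
  ...   | z , a′z = true≢false (trans (sym a′z) (proj₂ d (punchIn v z) (punchInᵢ≢i v z)))
  witness⇒¬prime-deletion v (a , just b , d) pGv
    with ≢⇒punchIn (witness-≢ {b = just b} d) | ≢⇒punchIn (witness-≢ {b} {just a} (DiffersOnlyAt-sym d))
  ... | a′ , refl | b′ , refl = prime⇒no-twins (G ─ v) pGv (λ { refl → proj₁ d refl }) twins
    where
      twins : ∀ z → z ≢ a′ → z ≢ b′ → adj (G ─ v) z a′ ≡ adj (G ─ v) z b′
      twins z _ _ = trans (∼-sym (punchIn v z) (punchIn v a′))
                          (trans (proj₂ d (punchIn v z) (punchInᵢ≢i v z)) (∼-sym (punchIn v b′) (punchIn v z)))

  module _ (v : Fin (suc m)) {M : Subset m} (M-module : IsModule (G ─ v) M) where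

    private
      ι : Fin m → Fin (suc m)
      ι = punchIn v

      S : Subset (suc m)
      S = lift v M

      ι-module : ∀ {z p q} → M z ≡ false → M p ≡ true → M q ≡ true → ι z ∼ ι p ≡ ι z ∼ ι q
      ι-module {z} {p} {q} Mz Mp Mq = M-module z Mz p q Mp Mq

      S-ι : ∀ {i b} → M i ≡ b → S (ι i) ≡ b
      S-ι {i} Mi = trans (lift-punchIn v M i) Mi

      ι-S : ∀ {i b} → S (ι i) ≡ b → M i ≡ b
      ι-S {i} Si = trans (sym (lift-punchIn v M i)) Si

    -- A vertex outside M is non-adjacent to the member of M on its own side, hence to all of M.
    two-sided⇒cut : ∀ {i k t} → M i ≡ true → M k ≡ false → M t ≡ true → side (ι t) ≢ side (ι i) → CutVertex v
    two-sided⇒cut {i} {k} {t} Mi Mk Mt t≢i =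
      S , lift-v v M , (ι i , S-ι Mi) , (ι k , punchInᵢ≢i v k , S-ι Mk) , no-edge-out
      where
        no-edge-out : NoEdgeOutExcept v S
        no-edge-out s r Ss Sr r≢v with s ≟ v | ≢⇒punchIn r≢v
        ... | yes refl | _ = ⊥-elim (true≢false (trans (sym Ss) (lift-v v M)))
        ... | no s≢v | r′ , refl with ≢⇒punchIn s≢v
        ...   | s′ , refl with side (ι r′) Bool.≟ side (ι i)
        ...     | yes r~i = ∼-flip (trans (ι-module (ι-S Sr) (ι-S Ss) Mi) (same-side⇒≁ r~i))
        ...     | no r≁i  = ∼-flip (trans (ι-module (ι-S Sr) (ι-S Ss) Mt) (same-side⇒≁ (≢-≢⇒≡ r≁i (t≢i ∘ sym))))

    module _ {i : Fin m} (one-sided : ∀ t → M t ≡ true → side (ι t) ≡ side (ι i)) where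

      uniform⇒G-module : (∀ p q → M p ≡ true → M q ≡ true → v ∼ ι p ≡ v ∼ ι q) → IsModule G S
      uniform⇒G-module uniform u Su p q Sp Sq with p ≟ v | q ≟ v
      ... | yes refl | _ = ⊥-elim (true≢false (trans (sym Sp) (lift-v v M)))
      ... | _ | yes refl = ⊥-elim (true≢false (trans (sym Sq) (lift-v v M)))
      ... | no p≢v | no q≢v with ≢⇒punchIn p≢v | ≢⇒punchIn q≢v
      ...   | p′ , refl | q′ , refl with u ≟ v
      ...     | yes refl = uniform p′ q′ (ι-S Sp) (ι-S Sq)
      ...     | no u≢v with ≢⇒punchIn u≢v
      ...       | u′ , refl = ι-module (ι-S Su) (ι-S Sp) (ι-S Sq)

      split⇒witness : ∀ {p q} → M p ≡ true → M q ≡ true → v ∼ ι p ≡ true → v ∼ ι q ≡ false → Witness v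
      split⇒witness {p} {q} Mp Mq vp vq =
        ι p , just (ι q) , (λ pv≡qv → true≢false (trans (sym (∼-flip vp)) (trans pv≡qv (∼-flip vq)))) , agree
        where
          agree : ∀ z → z ≢ v → ι p ∼ z ≡ ι q ∼ z
          agree z z≢v with ≢⇒punchIn z≢v
          ... | z′ , refl with true⊎false (M z′)
          ...   | inj₁ Mz = trans (same-side⇒≁ (trans (one-sided p Mp) (sym (one-sided z′ Mz))))
                                  (sym (same-side⇒≁ (trans (one-sided q Mq) (sym (one-sided z′ Mz)))))
          ...   | inj₂ Mz = trans (∼-sym (ι p) (ι z′)) (trans (ι-module Mz Mp Mq) (∼-sym (ι z′) (ι q)))

      ¬uniform : Prime G → ∀ {j} → M i ≡ true → M j ≡ true → i ≢ j →
                 ¬ (∀ p q → M p ≡ true → M q ≡ true → v ∼ ι p ≡ v ∼ ι q)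
      ¬uniform pG {j} Mi Mj i≢j uniform = prime⇒no-nontrivial-module G pG (uniform⇒G-module uniform)
        (ι i , ι j , v , S-ι Mi , S-ι Mj , i≢j ∘ punchIn-injective v i j , lift-v v M)

      one-sided⇒witness : Prime G → ∀ {j} → M i ≡ true → M j ≡ true → i ≢ j → Witness v
      one-sided⇒witness pG {j} Mi Mj i≢j
        with any? (λ p → (M p Bool.≟ true) ×-dec (v ∼ ι p Bool.≟ true))
           | any? (λ q → (M q Bool.≟ true) ×-dec (v ∼ ι q Bool.≟ false))
      ... | yes (p , Mp , vp) | yes (q , Mq , vq) = split⇒witness Mp Mq vp vq
      ... | no none-adjacent | _ =
        ⊥-elim (¬uniform pG Mi Mj i≢j λ p q Mp Mq → trans (non-adjacent p Mp) (sym (non-adjacent q Mq)))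
        where
          non-adjacent : ∀ p → M p ≡ true → v ∼ ι p ≡ false
          non-adjacent p Mp = ¬-not λ vp → none-adjacent (p , Mp , vp)
      ... | yes _ | no none-non-adjacent =
        ⊥-elim (¬uniform pG Mi Mj i≢j λ p q Mp Mq → trans (adjacent p Mp) (sym (adjacent q Mq)))
        where
          adjacent : ∀ p → M p ≡ true → v ∼ ι p ≡ true
          adjacent p Mp = ¬-not λ vp → none-non-adjacent (p , Mp , vp)

    nontrivial-deletion-module : Prime G → Nontrivial M → Witness v ⊎ CutVertex v
    nontrivial-deletion-module pG (i , j , k , Mi , Mj , i≢j , Mk)
      with any? (λ t → (M t Bool.≟ true) ×-dec ¬? (side (ι t) Bool.≟ side (ι i)))
    ... | yes (t , Mt , t≁i) = inj₂ (two-sided⇒cut Mi Mk Mt t≁i)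
    ... | no ¬two-sided = inj₁ (one-sided⇒witness one-sided pG Mi Mj i≢j)
      where
        one-sided : ∀ t → M t ≡ true → side (ι t) ≡ side (ι i)
        one-sided t Mt with side (ι t) Bool.≟ side (ι i)
        ... | yes t∼i = t∼i
        ... | no t≁i  = ⊥-elim (¬two-sided (t , Mt , t≁i))

  prime-deletion : Prime G → ∀ v → ¬ Witness v → ¬ CutVertex v → 3 ≤ m → Prime (G ─ v)
  prime-deletion pG v no-witness no-cut 3≤m = 3≤m , trivial
    where
      trivial : ∀ M → IsModule (G ─ v) M → IsTrivialModule M
      trivial M M-module with trivial⊎nontrivial M
      ... | inj₁ M-trivial = M-trivial
      ... | inj₂ nontrivial with nontrivial-deletion-module v M-module pG nontrivial
      ...   | inj₁ witness = ⊥-elim (no-witness witness)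
      ...   | inj₂ cut     = ⊥-elim (no-cut cut)


module FromCritical {m : ℕ} (G : Graph (suc m)) (side : Fin (suc m) → Bool) (bip : IsBipartition G side)
                (pG : Prime G) (3≤m : 3 ≤ m) (critical : ∀ v → ¬ Prime (G ─ v)) where
  open Bipartite G side bip
  open Deletion G side bip

  unwitnessed⇒cut-vertex : ∀ v → ¬ Witness v → ¬ ¬ CutVertex v
  unwitnessed⇒cut-vertex v ¬witness ¬cut = critical v (prime-deletion pG v ¬witness ¬cut 3≤m)

  pendant⇒witness : ∀ {v} → Pendant v → Witness v
  pendant⇒witness (a , d) = a , nothing , d

  cut-side-avoiding : ∀ {u w} → w ≢ u → CutVertex u → ∃ λ D → CutSide u D × D w ≡ false
  cut-side-avoiding {u} {w} w≢u (T , Tu , T-nonempty , (r , r≢u , Tr) , no-edge-out) with true⊎false (T w)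
  ... | inj₂ Tw = T , (Tu , T-nonempty , (r , r≢u , Tr) , no-edge-out) , Tw
  ... | inj₁ Tw = set rest? , (∉-set⁺ rest? (λ (_ , u≢u) → u≢u refl) , (r , ∈-set⁺ rest? (Tr , r≢u)) ,
                               (w , w≢u , w∉) , rest-no-edge-out) , w∉
    where
      rest? : ∀ z → Dec (T z ≡ false × z ≢ u)
      rest? z = (T z Bool.≟ false) ×-dec ¬? (z ≟ u)
      w∉ : set rest? w ≡ false
      w∉ = ∉-set⁺ rest? λ (Tw′ , _) → true≢false (trans (sym Tw) Tw′)
      rest-no-edge-out : NoEdgeOutExcept u (set rest?)
      rest-no-edge-out d z d∈ z∉ z≢u with ∈-set⁻ rest? d∈
      ... | Td , d≢u = ∼-flip (no-edge-out z d (¬-not λ Tz → ∉-set⁻ rest? z∉ (Tz , z≢u)) Td d≢u)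

  -- A cut vertex u ∈ S without witness would give a cut side at u avoiding w: inside S it is a smaller
  -- cut side, and disjoint from S it would be a component of G.
  module _ {w S} (cut : CutSide w S)
           (smaller-impossible : ∀ {u S′} → size S′ < size S → CutSide u S′ → ¬ Pendant u → ⊥) where

    private
      Sw : S w ≡ false
      Sw = proj₁ cut

      S-no-edge-out : NoEdgeOutExcept w S
      S-no-edge-out = proj₂ (proj₂ (proj₂ cut))

    S-witnessed : ∀ u → S u ≡ true → Witness u
    S-witnessed u Su with witness? u
    ... | yes witness = witness
    ... | no ¬witness = ⊥-elim (unwitnessed⇒cut-vertex u ¬witness λ u-cut → contradiction u-cut)
      where
        w≢u : w ≢ u
        w≢u refl = true≢false (trans (sym Su) Sw)
        contradiction : CutVertex u → ⊥
        contradiction u-cut with cut-side-avoiding w≢u u-cut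
        ... | D , (Du , (d , Dd) , _ , D-no-edge-out) , Dw
          with any? (λ z → (D z Bool.≟ true) ×-dec (S z Bool.≟ true))
        ...   | yes (s , Ds , Ss) = smaller-impossible smaller (D∩S-cut) (¬witness ∘ pendant⇒witness)
          where
            both? : ∀ z → Dec (D z ≡ true × S z ≡ true)
            both? z = (D z Bool.≟ true) ×-dec (S z Bool.≟ true)
            smaller : size (set both?) < size S
            smaller = size-mono-< {A = set both?} {B = S} (λ z z∈ → proj₂ (∈-set⁻ both? z∈)) u Su
                                  (∉-set⁺ both? λ (Du′ , _) → true≢false (trans (sym Du′) Du))
            D∩S-cut : CutSide u (set both?)
            D∩S-cut = ∉-set⁺ both? (λ (Du′ , _) → true≢false (trans (sym Du′) Du)) , (s , ∈-set⁺ both? (Ds , Ss)) ,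
                      (w , w≢u , ∉-set⁺ both? λ (Dw′ , _) → true≢false (trans (sym Dw′) Dw)) , no-edge-out
              where
                no-edge-out : NoEdgeOutExcept u (set both?)
                no-edge-out x z x∈ z∉ z≢u with ∈-set⁻ both? x∈ | true⊎false (D z)
                ... | Dx , _  | inj₂ Dz = D-no-edge-out x z Dx Dz z≢u
                ... | _  , Sx | inj₁ Dz =
                  S-no-edge-out x z Sx (¬-not λ Sz → ∉-set⁻ both? z∉ (Dz , Sz))
                    λ { refl → true≢false (trans (sym Dz) Dw) }
        ...   | no none = prime⇒connected G pG {D} D-closed Dd Du
          where
            D-closed : NoEdgeOut G D
            D-closed x z Dx Dz with z ≟ u
            ... | no z≢u   = D-no-edge-out x z Dx Dz z≢u
            ... | yes refl = ∼-flip (S-no-edge-out z x Su (¬-not λ Sx → none (x , Dx , Sx))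
                                      λ { refl → true≢false (trans (sym Dx) Dw) })

  cut-side-impossible : ∀ k {w S} → size S ≤ k → CutSide w S → ¬ Pendant w → ⊥
  cut-side-impossible zero    {S = S} S≤0 (_ , (s , Ss) , _) _ =
    ℕ.n≮0 (ℕ.<-≤-trans (size-mono-< {A = λ _ → false} {B = S} (λ _ ()) s Ss refl) S≤0)
  cut-side-impossible (suc k) S≤1+k cut no-pendant =
    InCutSide.witnessed-cut-side-impossible pG cut no-pendant
      (S-witnessed cut λ S′<S → cut-side-impossible k (ℕ.≤-pred (ℕ.≤-trans S′<S S≤1+k)))

  critical⇒witnessed : ∀ v → Witness v
  critical⇒witnessed v with witness? v
  ... | yes witness = witness
  ... | no ¬witness = ⊥-elim (unwitnessed⇒cut-vertex v ¬witness λ (S , cut) →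
                              cut-side-impossible (size S) ℕ.≤-refl cut (¬witness ∘ pendant⇒witness))

proposition5p3 : ∀ {n} (G : Graph n) (side : Fin n → Bool) →
    IsBipartition G side → 4 ≤ n →
      ((¬ HasInducedCopy P5 G × Prime G) ⇔ Critical G)
      × (Critical G ⇔ IsHalfGraph G side)
proposition5p3 {zero}  G side bip ()
proposition5p3 {suc m} G side bip (s≤s 3≤m) =
  mk⇔ (half⇒critical ∘ P5-free⇒half) (half⇒P5-free ∘ critical⇒half) , mk⇔ critical⇒half half⇒critical
  where
    open Bipartite G side bip
    open HalfGraphFrom2K₂-Free using (half-graph)
    open FromHalfGraph using (half⇒2K₂-free; half⇒prime)
    open AllWitnessed using (all-witnessed⇒2K₂-free)

    P5-free⇒half : ¬ HasInducedCopy P5 G × Prime G → IsHalfGraph G side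
    P5-free⇒half (P5-free , pG) = half-graph pG (prime∧P5-free⇒2K₂-free pG P5-free)

    half⇒P5-free : IsHalfGraph G side → ¬ HasInducedCopy P5 G × Prime G
    half⇒P5-free h = 2K₂-free⇒P5-free (half⇒2K₂-free h) , half⇒prime h (ℕ.m≤n⇒m≤1+n 3≤m)

    critical⇒half : Critical G → IsHalfGraph G side
    critical⇒half (pG , critical) = half-graph pG (all-witnessed⇒2K₂-free pG witnessed)
      where
        witnessed : ∀ v → Witness v
        witnessed = FromCritical.critical⇒witnessed G side bip pG 3≤m critical

    half⇒critical : IsHalfGraph G side → Critical G
    half⇒critical h = pG , λ v → Deletion.witness⇒¬prime-deletion G side bip v
                                   (prime∧2K₂-free⇒witness pG (half⇒2K₂-free h) v)
      where
        pG : Prime G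
        pG = half⇒prime h (ℕ.m≤n⇒m≤1+n 3≤m)
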